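{- Fix integers $t\geq 1$, $C_1,\dots,C_t\geq 1$, $A_1,\dots,A_t$ and $B_1,\dots,B_t$ with $0\leq A_i\leq C_i/2$ and $0\leq B_i\leq C_i/2$ for all $i$, an integer $m\geq 0$, and an integer $N_0\geq 1$. Let $S$ be the multiset which, for each $i$, contains one copy of the positive integers congruent to $A_i$ modulo $C_i$ and one separate copy of the positive integers congruent to $-A_i$ modulo $C_i$; define $T$ in the same way using the $B_i$. Let $D_S(N)$ (respectively $D_T(N)$) be the number of partitions of $N$ into distinct elements of $S$ (respectively $T$), elements from different copies counting as distinct, where such partitions are required to have an odd number of parts if no $A_i$ (respectively no $B_i$) equals zero. Set $p=|\{i:B_i=0\}|-|\{i:A_i=0\}|$, with the convention that each of these cardinalities is taken to be $1$ if the corresponding set is empty. Then the following are equivalent: (i) For every integer $N\geq N_0$, the number of tuples $(\mu_1,\dots,\mu_t;d_1,\dots,d_t)$ with $\mu_i\in P$, $d_i\in\mathbb Z$, $\sum_i d_i$ odd, and $$\sum_{i=1}^{t}C_i|\mu_i|+\sum_{i=1}^{t}C_i\binom{d_i}{2}+\sum_{i=1}^{t}A_{i}d_{i}=N$$ equals the number of tuples $(\alpha_1,\dots,\alpha_t;e_1,\dots,e_t)$ with $\alpha_i\in P$, $e_i\in\mathbb Z$, $\sum_i e_i$ odd, and $$\sum_{i=1}^{t}C_i|\alpha_i|+\sum_{i=1}^{t}C_i\binom{e_i}{2}+\sum_{i=1}^{t}B_{i}e_{i}+m=N;$$ (ii) For every integer $N\geq N_0$, $D_S(N)=2^p\cdot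 D_T(N-m)$.
   Context: $P$ denotes the set of all integer partitions into positive parts (including the empty partition, the unique partition of $0$); $|\nu|$ is the sum of the parts of $\nu$. For $d\in\mathbb Z$, $\binom{d}{2}=d(d-1)/2$. -}

module Defs where

open import Data.Nat as ℕ using (ℕ; zero; suc; _<_; _≥_; _>_; _%_)
open import Data.Nat.Combinatorics using () renaming (_C_ to _choose_)
open import Data.Integer as ℤ using (ℤ; +_; -[1+_]; ∣_∣)
open import Data.Integer.Divisibility using (_∣_)
open import Data.Fin using (Fin; zero; suc)
open import Data.Vec using (Vec; lookup)
open import Data.List using (List; length)
open import Data.Nat.ListAction using (sum)
open import Data.List.Relation.Unary.All using (All)
open import Data.List.Relation.Unary.Linked using (Linked)
open import Data.Product using (Σ; _×_; proj₁; proj₂)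
open import Data.Unit using (⊤)
open import Data.Bool using (Bool; true; false)
open import Relation.Binary.PropositionalEquality using (_≡_)
open import Relation.Nullary using (does)

Σℤ : ∀ {n} → (Fin n → ℤ) → ℤ
Σℤ {zero}  f = + 0
Σℤ {suc n} f = f zero ℤ.+ Σℤ (λ i → f (suc i))

Σℕ : ∀ {n} → (Fin n → ℕ) → ℕ
Σℕ {zero}  f = 0
Σℕ {suc n} f = f zero ℕ.+ Σℕ (λ i → f (suc i))

#zeros : ∀ {n} → (Fin n → ℕ) → ℕ
#zeros {zero}  a = 0
#zeros {suc n} a with does (a zero ℕ.≟ 0)
... | true  = suc (#zeros (λ i → a (suc i)))
... | false = #zeros (λ i → a (suc i))

-- the paper's convention: the cardinality is taken to be 1 if the set is empty
#zeros′ : ∀ {n} → (Fin n → ℕ) → ℕ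
#zeros′ a with #zeros a
... | zero  = 1
... | suc k = suc k

anyZero : ∀ {n} → (Fin n → ℕ) → Bool
anyZero a with #zeros a
... | zero  = false
... | suc _ = true

OddNat : ℕ → Set
OddNat n = n % 2 ≡ 1

OddInt : ℤ → Set
OddInt z = OddNat ∣ z ∣

binom2 : ℤ → ℤ
binom2 (+ n)      = + (n choose 2)
binom2 -[1+ n ]   = + ((suc (suc n)) choose 2)  -- (-(n+1))(-(n+2))/2 = (n+2)(n+1)/2

record Partition : Set where
  constructor mkPartition
  field
    parts    : List ℕ
    weakDecr : Linked _≥_ parts
    positive : All (0 <_) parts

∣_∣ₚ : Partition → ℕ
∣ μ ∣ₚ = sum (Partition.parts μ)

record DistinctIn (P : ℕ → Set) : Set where
  constructor mkDistinct
  field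
    elems    : List ℕ
    strDecr  : Linked _>_ elems
    good     : All (λ k → 0 < k × P k) elems

CongPlus : ℕ → ℕ → ℕ → Set
CongPlus c a k = (+ c) ∣ (+ k ℤ.- + a)

CongMinus : ℕ → ℕ → ℕ → Set
CongMinus c a k = (+ c) ∣ (+ k ℤ.+ + a)

Tuple : (n : ℕ) → (Fin n → Set) → Set
Tuple zero    P = ⊤
Tuple (suc n) P = P zero × Tuple n (λ i → P (suc i))

get : ∀ {n} {P : Fin n → Set} → Tuple n P → (i : Fin n) → P i
get {suc n} x zero    = proj₁ x
get {suc n} x (suc i) = get (proj₂ x) i

-- A partition into distinct elements of the multiset S(C,A): for each i,
-- a finite set from the copy {k>0 : k ≡ A_i mod C_i} and a finite set
-- from the separate copy {k>0 : k ≡ -A_i mod C_i}.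

SPart : ∀ {t} → (C A : Fin t → ℕ) → Set
SPart {t} C A =
  Tuple t (λ i → DistinctIn (CongPlus (C i) (A i))
                × DistinctIn (CongMinus (C i) (A i)))

SPartSum : ∀ {t} {C A : Fin t → ℕ} → SPart C A → ℕ
SPartSum {C = C} {A} x =
  Σℕ (λ i → sum (DistinctIn.elems (proj₁ (get x i)))
           ℕ.+ sum (DistinctIn.elems (proj₂ (get x i))))

SPartLength : ∀ {t} {C A : Fin t → ℕ} → SPart C A → ℕ
SPartLength {C = C} {A} x =
  Σℕ (λ i → length (DistinctIn.elems (proj₁ (get x i)))
           ℕ.+ length (DistinctIn.elems (proj₂ (get x i))))

ParityReq : Bool → ℕ → Set
ParityReq true  n = ⊤
ParityReq false n = OddNat n

-- The set counted by D_S(M) (M ∈ ℤ; empty if M < 0).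
DS : ∀ {t} → (C A : Fin t → ℕ) → ℤ → Set
DS C A M = Σ (SPart C A) λ x →
  (+ SPartSum x ≡ M) × ParityReq (anyZero A) (SPartLength x)

Sol : ∀ {t} → (C A : Fin t → ℕ) → (k N : ℕ) → Set
Sol {t} C A k N =
  Σ (Vec Partition t) λ μ → Σ (Vec ℤ t) λ d →
    OddInt (Σℤ (lookup d)) ×
    (Σℤ (λ i → + C i ℤ.* + ∣ lookup μ i ∣ₚ)
      ℤ.+ Σℤ (λ i → + C i ℤ.* binom2 (lookup d i))
      ℤ.+ Σℤ (λ i → + A i ℤ.* lookup d i)
      ℤ.+ + k
      ≡ + N)

module Submission where

-- Both sides of the equivalence are compared with one common object.  For
-- fixed (C, A) and k, N we construct an explicit bijection
--
--     Fin 2 × Sol C A k N  ↔  Fin (2 ^ #zeros′ A) × DS C A (N - k)       (side)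
--
-- Then (i) ⇒ (ii) is immediate, and (ii) ⇒ (i) follows by cancelling the
-- factor Fin 2 between finite types (all the sets involved are finite).
--
-- The bijection is a bijective proof of the Jacobi triple product, applied
-- factor by factor.  A "configuration" is a pair (P, M) of finite subsets of ℕ;
-- the shift σ of the Maya diagram changes the charge |P| - |M| by one and
-- preserves weight - binom2(charge), which yields
--     Partition × ℤ  ↔  configurations,   weight = |λ| + binom2 d, charge = d.
-- Placing the elements p ∈ P at A + pC and m ∈ M at (C - A) + mC turns a
-- configuration into a pair of sets of distinct parts ≡ ±A (mod C) whose sum is
-- C·weight + A·charge; when A = 0 the element 0 ∈ P has no image and is
-- recorded as an extra bit.  Taking the product over i and keeping track of the
-- parity of Σ dᵢ gives (side): the extra bits account for the factor
-- 2 ^ #zeros A, and halving by one of them removes the parity condition.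

open import Data.Nat as ℕ using (ℕ; zero; suc; _+_; _*_; _^_; _∸_; _%_; _≤_; _<_; _>_; _≥_; _≤?_; z≤n; s≤s; NonZero)
import Data.Nat.Properties as ℕP
open import Data.Nat.Combinatorics using () renaming (_C_ to _choose_)
import Data.Nat.Combinatorics as Comb
open import Data.Nat.DivMod using (_/_; m*n/n≡m; m/n*n≡m; [m+kn]%n≡m%n)
open import Data.Nat.Divisibility as ℕD using (divides; ∣⇒≤)
open import Data.Nat.ListAction using (sum)
open import Data.Nat.ListAction.Properties using (sum-↭)
open import Data.Integer as ℤ using (ℤ; +_; -[1+_]; _-_; ∣_∣)
import Data.Integer.Properties as ℤP
open import Data.Fin using (Fin; zero; suc; toℕ; fromℕ<)
import Data.Fin.Properties as FinP
open import Data.Fin.Permutation using (↔⇒≡)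
open import Data.Vec using (Vec; []; _∷_; lookup)
open import Data.List using (List; []; _∷_; length; map; reverse; _∷ʳ_)
import Data.List.Properties as LP
open import Data.List.Relation.Binary.Permutation.Propositional.Properties using (↭-reverse)
open import Data.List.Relation.Unary.Linked as Lk using (Linked; []; [-]; _∷_)
open import Data.List.Relation.Unary.All as All using (All; []; _∷_)
open import Data.Product using (Σ; _×_; _,_; proj₁; proj₂)
open import Data.Product.Function.NonDependent.Propositional using (_×-↔_)
open import Data.Sum using (_⊎_; inj₁; inj₂)
open import Data.Sum.Function.Propositional using (_⊎-↔_)
open import Data.Bool using (Bool; true; false; not; _xor_)
import Data.Bool.Properties as BP
open import Data.Unit using (⊤; tt)
open import Data.Empty using (⊥; ⊥-elim)
open import Relation.Nullary using (Dec; yes; no; does)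
open import Relation.Nullary.Decidable using (_×-dec_)
open import Relation.Unary using (Irrelevant)
open import Relation.Binary.PropositionalEquality
open import Relation.Binary.Definitions using (tri<; tri≈; tri>)
open import Function.Bundles using (_↔_; _⇔_; Inverse; mk↔ₛ′; mk⇔)
open import Function.Properties.Inverse using (↔-refl; ↔-sym; ↔-trans)
open import Axiom.UniquenessOfIdentityProofs using (module Decidable⇒UIP)
open import Data.Integer.Tactic.RingSolver using (solve-∀)
open import Data.Nat.Tactic.RingSolver using () renaming (solve-∀ to solve-∀ℕ)
open import Defs

open Inverse using (to; from) renaming (strictlyInverseˡ to to-from; strictlyInverseʳ to from-to)

infixr 4 _⊙_
_⊙_ : ∀ {A B C : Set} → A ↔ B → B ↔ C → A ↔ C
_⊙_ = ↔-trans

ℤ-irrelevant : ∀ {a b : ℤ} (p q : a ≡ b) → p ≡ q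
ℤ-irrelevant = Decidable⇒UIP.≡-irrelevant ℤ._≟_

Bool-irrelevant : ∀ {a b : Bool} (p q : a ≡ b) → p ≡ q
Bool-irrelevant = Decidable⇒UIP.≡-irrelevant BP._≟_

Fin-irrelevant : ∀ {n} {a b : Fin n} (p q : a ≡ b) → p ≡ q
Fin-irrelevant = Decidable⇒UIP.≡-irrelevant FinP._≟_

prop-↔ : ∀ {P Q : Set} → (P → Q) → (Q → P) → (∀ (p p′ : P) → p ≡ p′) → (∀ (q q′ : Q) → q ≡ q′) → P ↔ Q
prop-↔ f g irrP irrQ = mk↔ₛ′ f g (λ q → irrQ _ q) (λ p → irrP _ p)

Σ-congʳ : ∀ {A : Set} {P Q : A → Set} → (∀ a → P a ↔ Q a) → Σ A P ↔ Σ A Q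
Σ-congʳ f = mk↔ₛ′ (λ (a , p) → a , to (f a) p) (λ (a , q) → a , from (f a) q)
  (λ (a , q) → cong (a ,_) (to-from (f a) q)) (λ (a , p) → cong (a ,_) (from-to (f a) p))

Σ-≡ : ∀ {A : Set} {P : A → Set} → Irrelevant P → {x y : A} {p : P x} {q : P y} → x ≡ y → (x , p) ≡ (y , q)
Σ-≡ irr {p = p} {q} refl = cong (_ ,_) (irr p q)

Σ-↔ : ∀ {A B : Set} {P : A → Set} {Q : B → Set} (f : A ↔ B) →
  (∀ x → P x → Q (to f x)) → (∀ y → Q y → P (from f y)) → Irrelevant P → Irrelevant Q → Σ A P ↔ Σ B Q
Σ-↔ f pq qp irrP irrQ = mk↔ₛ′ (λ (a , p) → to f a , pq a p) (λ (b , q) → from f b , qp b q)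
  (λ (b , q) → Σ-≡ irrQ (to-from f b)) (λ (a , p) → Σ-≡ irrP (from-to f a))

Σ-↔-stat : ∀ {X Y S : Set} (f : X ↔ Y) (sX : X → S) (sY : Y → S) → (∀ x → sX x ≡ sY (to f x)) →
  (Q : S → Set) → Irrelevant Q → Σ X (λ x → Q (sX x)) ↔ Σ Y (λ y → Q (sY y))
Σ-↔-stat f sX sY e Q irr = Σ-↔ f (λ x p → subst Q (e x) p)
  (λ y q → subst Q (sym (trans (e (from f y)) (cong sY (to-from f y)))) q) irr irr

choose2-suc : ∀ n → suc n choose 2 ≡ n choose 2 + n
choose2-suc n = trans (sym (Comb.nCk+nC[k+1]≡[n+1]C[k+1] n 1))
  (trans (cong (_+ (n choose 2)) (Comb.nC1≡n n)) (ℕP.+-comm n _))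

binom2-suc : ∀ z → binom2 (ℤ.suc z) ≡ binom2 z ℤ.+ z
binom2-suc (+ n) = trans (cong +_ (choose2-suc n)) (ℤP.pos-+ (n choose 2) n)
binom2-suc -[1+ zero ] = refl
binom2-suc -[1+ suc n ] = sym (begin
  + (suc (suc (suc n)) choose 2) ℤ.+ -[1+ suc n ]          ≡⟨ cong (λ k → + k ℤ.+ -[1+ suc n ]) (choose2-suc (suc (suc n))) ⟩
  + (b + suc (suc n)) ℤ.+ -[1+ suc n ]                      ≡⟨ cong (ℤ._+ -[1+ suc n ]) (ℤP.pos-+ b (suc (suc n))) ⟩
  (+ b ℤ.+ + suc (suc n)) ℤ.+ -[1+ suc n ]                  ≡⟨ ℤP.+-assoc (+ b) (+ suc (suc n)) -[1+ suc n ] ⟩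
  + b ℤ.+ (+ suc (suc n) ℤ.+ -[1+ suc n ])                  ≡⟨ cong (ℤ._+_ (+ b)) (ℤP.+-inverseʳ (+ suc (suc n))) ⟩
  + b ℤ.+ + 0                                               ≡⟨ ℤP.+-identityʳ (+ b) ⟩
  + b ∎)
  where
  open ≡-Reasoning
  b = suc (suc n) choose 2

-- Configurations and the shift σ

-- A finite subset {x₁ < x₂ < … < x_k} of ℕ is coded by its list of gaps
-- (x₁, x₂ - x₁ - 1, …, x_k - x_{k-1} - 1); every list of naturals codes a set.
-- `inc` adds one to every element, `0 ∷ G` codes {0} ∪ (G + 1), and `setSum`
-- is the sum of the elements.
inc : List ℕ → List ℕ
inc [] = []
inc (g ∷ gs) = suc g ∷ gs

setSum : List ℕ → ℕ
setSum [] = 0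
setSum (g ∷ gs) = g * suc (length gs) + length gs + setSum gs

length-inc : ∀ G → length (inc G) ≡ length G
length-inc [] = refl
length-inc (g ∷ G) = refl

setSum-inc : ∀ G → setSum (inc G) ≡ setSum G + length G
setSum-inc [] = refl
setSum-inc (g ∷ gs) = shift g (length gs) (setSum gs)
  where
  shift : ∀ g l s → suc g * suc l + l + s ≡ g * suc l + l + s + suc l
  shift = solve-∀ℕ

-- A configuration (P, M) is a pair of finite subsets of ℕ (positions of
-- particles and of holes of a Maya diagram).  Its weight is
-- Σ_{p ∈ P} p + Σ_{m ∈ M} (m + 1) and its charge is |P| - |M|.
Config : Set
Config = List ℕ × List ℕ

weight : Config → ℕ
weight (P , M) = setSum P + setSum M + length M

charge : Config → ℤ
charge (P , M) = + length P - + length M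

-- The shift σ: if 0 ∈ M, remove it and move all other elements of M down by
-- one and all elements of P up by one; otherwise add 0 to P, moving P up and
-- M down.
σ : Config → Config
σ (P , []) = 0 ∷ P , []
σ (P , zero ∷ M) = inc P , M
σ (P , suc g ∷ M) = 0 ∷ P , g ∷ M

σ⁻¹ : Config → Config
σ⁻¹ ([] , M) = [] , 0 ∷ M
σ⁻¹ (zero ∷ P , M) = P , inc M
σ⁻¹ (suc g ∷ P , M) = g ∷ P , 0 ∷ M

σσ⁻¹ : ∀ c → σ (σ⁻¹ c) ≡ c
σσ⁻¹ ([] , []) = refl
σσ⁻¹ ([] , g ∷ M) = refl
σσ⁻¹ (zero ∷ P , []) = refl
σσ⁻¹ (zero ∷ P , g ∷ M) = refl
σσ⁻¹ (suc g ∷ P , M) = refl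

σ⁻¹σ : ∀ c → σ⁻¹ (σ c) ≡ c
σ⁻¹σ (P , []) = refl
σ⁻¹σ ([] , zero ∷ M) = refl
σ⁻¹σ (g ∷ P , zero ∷ M) = refl
σ⁻¹σ (P , suc g ∷ M) = refl

σ-injective : ∀ {x y} → σ x ≡ σ y → x ≡ y
σ-injective {x} {y} e = trans (sym (σ⁻¹σ x)) (trans (cong σ⁻¹ e) (σ⁻¹σ y))

σ-charge : ∀ c → charge (σ c) ≡ ℤ.suc (charge c)
σ-charge (P , []) = sym (ℤP.+-assoc (+ 1) (+ length P) (ℤ.- + 0))
σ-charge (P , zero ∷ M) rewrite length-inc P = L (+ length P) (+ length M)
  where
  L : ∀ (x y : ℤ) → x ℤ.- y ≡ + 1 ℤ.+ (x ℤ.- (+ 1 ℤ.+ y))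
  L = solve-∀
σ-charge (P , suc g ∷ M) = L (+ length P) (+ length M)
  where
  L : ∀ (x y : ℤ) → (+ 1 ℤ.+ x) ℤ.- (+ 1 ℤ.+ y) ≡ + 1 ℤ.+ (x ℤ.- (+ 1 ℤ.+ y))
  L = solve-∀

σ⁻¹-charge : ∀ c → ℤ.suc (charge (σ⁻¹ c)) ≡ charge c
σ⁻¹-charge c = trans (sym (σ-charge (σ⁻¹ c))) (cong charge (σσ⁻¹ c))

-- σ raises the weight by the charge: weight (σ c) = weight c + charge c,
-- first in the ℕ form weight (σ c) + |M| = weight c + |P|.
σ-weightℕ : ∀ c → weight (σ c) + length (proj₂ c) ≡ weight c + length (proj₁ c)
σ-weightℕ (P , []) = L (setSum P) (length P)
  where
  L : ∀ s l → l + s + 0 + 0 + 0 ≡ s + 0 + 0 + l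
  L = solve-∀ℕ
σ-weightℕ (P , zero ∷ M) =
  trans (cong (λ x → x + setSum M + length M + suc (length M)) (setSum-inc P)) (L (setSum P) (length P) (setSum M) (length M))
  where
  L : ∀ s l t m → s + l + t + m + suc m ≡ s + (0 + m + t) + suc m + l
  L = solve-∀ℕ
σ-weightℕ (P , suc g ∷ M) = L (setSum P) (length P) (setSum M) (length M) g
  where
  L : ∀ s l t m g → l + s + (g * suc m + m + t) + suc m + suc m ≡ s + (suc g * suc m + m + t) + suc m + l
  L = solve-∀ℕ

σ-weight : ∀ c → + weight (σ c) ≡ + weight c ℤ.+ charge c
σ-weight c@(P , M) = begin
  + weight (σ c)                                    ≡⟨ L (+ weight (σ c)) (+ length M) ⟩
  (+ weight (σ c) ℤ.+ + length M) ℤ.- + length M    ≡⟨ cong (ℤ._- + length M) (sym (ℤP.pos-+ (weight (σ c)) (length M))) ⟩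
  + (weight (σ c) + length M) ℤ.- + length M        ≡⟨ cong (λ x → + x ℤ.- + length M) (σ-weightℕ c) ⟩
  + (weight c + length P) ℤ.- + length M            ≡⟨ cong (ℤ._- + length M) (ℤP.pos-+ (weight c) (length P)) ⟩
  (+ weight c ℤ.+ + length P) ℤ.- + length M        ≡⟨ ℤP.+-assoc (+ weight c) (+ length P) (ℤ.- + length M) ⟩
  + weight c ℤ.+ charge c ∎
  where
  open ≡-Reasoning
  L : ∀ (x y : ℤ) → x ≡ (x ℤ.+ y) ℤ.- y
  L = solve-∀

-- Consequently the reduced weight ρ = weight - binom2 charge is σ-invariant.
ρ : Config → ℤ
ρ c = + weight c ℤ.- binom2 (charge c)

σ-ρ : ∀ c → ρ (σ c) ≡ ρ c
σ-ρ c rewrite σ-weight c | σ-charge c | binom2-suc (charge c) = L (+ weight c) (charge c) (binom2 (charge c))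
  where
  L : ∀ (w h b : ℤ) → (w ℤ.+ h) ℤ.- (b ℤ.+ h) ≡ w ℤ.- b
  L = solve-∀

σ⁻¹-ρ : ∀ c → ρ (σ⁻¹ c) ≡ ρ c
σ⁻¹-ρ c = trans (sym (σ-ρ (σ⁻¹ c))) (cong ρ (σσ⁻¹ c))

σ^ : ℤ → Config → Config
σ^ (+ zero) c = c
σ^ (+ suc n) c = σ (σ^ (+ n) c)
σ^ -[1+ zero ] c = σ⁻¹ c
σ^ -[1+ suc n ] c = σ⁻¹ (σ^ -[1+ n ] c)

σ^-suc : ∀ z c → σ^ (ℤ.suc z) c ≡ σ (σ^ z c)
σ^-suc (+ n) c = refl
σ^-suc -[1+ zero ] c = sym (σσ⁻¹ c)
σ^-suc -[1+ suc n ] c = sym (σσ⁻¹ _)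

σ^-invariant : ∀ (P : Config → Set) → (∀ c → P c → P (σ c)) → (∀ c → P c → P (σ⁻¹ c)) → ∀ z c → P c → P (σ^ z c)
σ^-invariant P up down (+ zero) c p = p
σ^-invariant P up down (+ suc n) c p = up _ (σ^-invariant P up down (+ n) c p)
σ^-invariant P up down -[1+ zero ] c p = down c p
σ^-invariant P up down -[1+ suc n ] c p = down _ (σ^-invariant P up down -[1+ n ] c p)

σ^-ρ : ∀ z c → ρ (σ^ z c) ≡ ρ c
σ^-ρ z c = σ^-invariant (λ x → ρ x ≡ ρ c) (λ x e → trans (σ-ρ x) e) (λ x e → trans (σ⁻¹-ρ x) e) z c refl

σ^-charge : ∀ z c → charge (σ^ z c) ≡ charge c ℤ.+ z
σ^-charge (+ zero) c = sym (ℤP.+-identityʳ (charge c))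
σ^-charge (+ suc n) c = begin
  charge (σ (σ^ (+ n) c))      ≡⟨ σ-charge (σ^ (+ n) c) ⟩
  ℤ.suc (charge (σ^ (+ n) c))  ≡⟨ cong ℤ.suc (σ^-charge (+ n) c) ⟩
  + 1 ℤ.+ (charge c ℤ.+ + n)   ≡⟨ L (charge c) (+ n) ⟩
  charge c ℤ.+ + suc n ∎
  where
  open ≡-Reasoning
  L : ∀ (x y : ℤ) → + 1 ℤ.+ (x ℤ.+ y) ≡ x ℤ.+ (+ 1 ℤ.+ y)
  L = solve-∀
σ^-charge -[1+ zero ] c = begin
  charge (σ⁻¹ c)                              ≡⟨ L (charge (σ⁻¹ c)) ⟩
  ℤ.suc (charge (σ⁻¹ c)) ℤ.+ -[1+ 0 ]         ≡⟨ cong (ℤ._+ -[1+ 0 ]) (σ⁻¹-charge c) ⟩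
  charge c ℤ.+ -[1+ 0 ] ∎
  where
  open ≡-Reasoning
  L : ∀ (x : ℤ) → x ≡ (+ 1 ℤ.+ x) ℤ.+ -[1+ 0 ]
  L = solve-∀
σ^-charge -[1+ suc n ] c = begin
  charge (σ⁻¹ c′)                             ≡⟨ L (charge (σ⁻¹ c′)) ⟩
  ℤ.suc (charge (σ⁻¹ c′)) ℤ.+ -[1+ 0 ]        ≡⟨ cong (ℤ._+ -[1+ 0 ]) (σ⁻¹-charge c′) ⟩
  charge c′ ℤ.+ -[1+ 0 ]                      ≡⟨ cong (ℤ._+ -[1+ 0 ]) (σ^-charge -[1+ n ] c) ⟩
  (charge c ℤ.+ -[1+ n ]) ℤ.+ -[1+ 0 ]        ≡⟨ ℤP.+-assoc (charge c) -[1+ n ] -[1+ 0 ] ⟩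
  charge c ℤ.+ -[1+ suc (n + 0) ]             ≡⟨ cong (λ k → charge c ℤ.+ -[1+ suc k ]) (ℕP.+-identityʳ n) ⟩
  charge c ℤ.+ -[1+ suc n ] ∎
  where
  open ≡-Reasoning
  c′ = σ^ -[1+ n ] c
  L : ∀ (x : ℤ) → x ≡ (+ 1 ℤ.+ x) ℤ.+ -[1+ 0 ]
  L = solve-∀

-- Applying σ until M is empty and then σ⁻¹ while 0 ∈ P leads to a
-- configuration (Q, ∅) with 0 ∉ Q, the core.  `coreOf` follows exactly the
-- clauses of σ, so the core is σ-invariant by computation.
dropZeros : List ℕ → List ℕ
dropZeros [] = []
dropZeros (zero ∷ P) = dropZeros P
dropZeros (suc g ∷ P) = suc g ∷ P

mutual
  coreOf : List ℕ → List ℕ → List ℕ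
  coreOf P [] = dropZeros P
  coreOf P (g ∷ M) = coreOf′ P g M

  coreOf′ : List ℕ → ℕ → List ℕ → List ℕ
  coreOf′ P zero M = coreOf (inc P) M
  coreOf′ P (suc g) M = coreOf′ (0 ∷ P) g M

core : Config → List ℕ
core (P , M) = coreOf P M

core-σ : ∀ c → core (σ c) ≡ core c
core-σ (P , []) = refl
core-σ (P , zero ∷ M) = refl
core-σ (P , suc g ∷ M) = refl

core-σ⁻¹ : ∀ c → core (σ⁻¹ c) ≡ core c
core-σ⁻¹ c = trans (sym (core-σ (σ⁻¹ c))) (cong core (σσ⁻¹ c))

core-σ^ : ∀ z c → core (σ^ z c) ≡ core c
core-σ^ z c = σ^-invariant (λ x → core x ≡ core c) (λ x e → trans (core-σ x) e) (λ x e → trans (core-σ⁻¹ x) e) z c refl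

-- The codes of sets not containing 0 are exactly the lists inc G.
inc⁻¹ : List ℕ → List ℕ
inc⁻¹ [] = []
inc⁻¹ (zero ∷ G) = zero ∷ G
inc⁻¹ (suc g ∷ G) = g ∷ G

inc⁻¹-inc : ∀ G → inc⁻¹ (inc G) ≡ G
inc⁻¹-inc [] = refl
inc⁻¹-inc (g ∷ G) = refl

Canonical : List ℕ → Set
Canonical Q = inc (inc⁻¹ Q) ≡ Q

inc-canonical : ∀ G → Canonical (inc G)
inc-canonical G = cong inc (inc⁻¹-inc G)

dropZeros-canonical : ∀ P → Canonical (dropZeros P)
dropZeros-canonical [] = refl
dropZeros-canonical (zero ∷ P) = dropZeros-canonical P
dropZeros-canonical (suc g ∷ P) = refl

dropZeros-id : ∀ Q → Canonical Q → dropZeros Q ≡ Q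
dropZeros-id [] _ = refl
dropZeros-id (zero ∷ Q) ()
dropZeros-id (suc g ∷ Q) _ = refl

coreOf-canonical : ∀ P M → Canonical (coreOf P M)
coreOf′-canonical : ∀ P g M → Canonical (coreOf′ P g M)
coreOf-canonical P [] = dropZeros-canonical P
coreOf-canonical P (g ∷ M) = coreOf′-canonical P g M
coreOf′-canonical P zero M = coreOf-canonical (inc P) M
coreOf′-canonical P (suc g) M = coreOf′-canonical (0 ∷ P) g M

Recovers : Config → Set
Recovers c = σ^ (charge c ℤ.- + length (core c)) (core c , []) ≡ c

exponent-σ : ∀ c → charge (σ c) ℤ.- + length (core (σ c)) ≡ ℤ.suc (charge c ℤ.- + length (core c))
exponent-σ c rewrite core-σ c | σ-charge c = L (charge c) (+ length (core c))
  where
  L : ∀ (x y : ℤ) → (+ 1 ℤ.+ x) ℤ.- y ≡ + 1 ℤ.+ (x ℤ.- y)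
  L = solve-∀

recovers-σ : ∀ c → Recovers c → Recovers (σ c)
recovers-σ c h = begin
  σ^ (charge (σ c) ℤ.- + length (core (σ c))) (core (σ c) , [])  ≡⟨ cong (λ q → σ^ (charge (σ c) ℤ.- + length (core (σ c))) (q , [])) (core-σ c) ⟩
  σ^ (charge (σ c) ℤ.- + length (core (σ c))) (core c , [])      ≡⟨ cong (λ z → σ^ z (core c , [])) (exponent-σ c) ⟩
  σ^ (ℤ.suc e) (core c , [])                                     ≡⟨ σ^-suc e (core c , []) ⟩
  σ (σ^ e (core c , []))                                         ≡⟨ cong σ h ⟩
  σ c ∎
  where
  open ≡-Reasoning
  e = charge c ℤ.- + length (core c)

recovers-σ⁻¹ : ∀ c → Recovers (σ c) → Recovers c
recovers-σ⁻¹ c h = σ-injective (begin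
  σ (σ^ e (core c , []))                                         ≡⟨ sym (σ^-suc e (core c , [])) ⟩
  σ^ (ℤ.suc e) (core c , [])                                     ≡⟨ cong (λ z → σ^ z (core c , [])) (sym (exponent-σ c)) ⟩
  σ^ (charge (σ c) ℤ.- + length (core (σ c))) (core c , [])      ≡⟨ cong (λ q → σ^ (charge (σ c) ℤ.- + length (core (σ c))) (q , [])) (sym (core-σ c)) ⟩
  σ^ (charge (σ c) ℤ.- + length (core (σ c))) (core (σ c) , [])  ≡⟨ h ⟩
  σ c ∎)
  where
  open ≡-Reasoning
  e = charge c ℤ.- + length (core c)

recovers-nil : ∀ P → Recovers (P , [])
recovers-nil [] = refl
recovers-nil (zero ∷ P) = recovers-σ (P , []) (recovers-nil P)
recovers-nil (suc g ∷ P) = cong (λ z → σ^ z (suc g ∷ P , [])) (L (length P))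
  where
  L : ∀ l → (+ suc l ℤ.- + 0) ℤ.- + suc l ≡ + 0
  L l = trans (cong (ℤ._- + suc l) (ℤP.+-identityʳ (+ suc l))) (ℤP.+-inverseʳ (+ suc l))

recovers : ∀ P M → Recovers (P , M)
recovers′ : ∀ P g M → Recovers (P , g ∷ M)
recovers P [] = recovers-nil P
recovers P (g ∷ M) = recovers′ P g M
recovers′ P zero M = recovers-σ⁻¹ (P , zero ∷ M) (recovers (inc P) M)
recovers′ P (suc g) M = recovers-σ⁻¹ (P , suc g ∷ M) (recovers′ (0 ∷ P) g M)

configOf : List ℕ × ℤ → Config
configOf (G , d) = σ^ (d ℤ.- + length G) (inc G , [])

configOf-charge : ∀ G d → charge (configOf (G , d)) ≡ d
configOf-charge G d = trans (σ^-charge (d ℤ.- + length G) (inc G , [])) (base G d)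
  where
  base : ∀ G d → charge (inc G , []) ℤ.+ (d ℤ.- + length G) ≡ d
  base G d rewrite length-inc G = L (+ length G) d
    where
    L : ∀ (x d : ℤ) → (x ℤ.- + 0) ℤ.+ (d ℤ.- x) ≡ d
    L = solve-∀

coordinates : (List ℕ × ℤ) ↔ Config
coordinates = mk↔ₛ′ configOf (λ c → inc⁻¹ (core c) , charge c) configOf-coords coords-configOf
  where
  configOf-coords : ∀ c → configOf (inc⁻¹ (core c) , charge c) ≡ c
  configOf-coords c@(P , M) = trans
    (cong (λ l → σ^ (charge c ℤ.- + l) (inc (inc⁻¹ (core c)) , [])) (sym (length-inc (inc⁻¹ (core c)))))
    (subst (λ q → σ^ (charge c ℤ.- + length q) (q , []) ≡ c) (sym (coreOf-canonical P M)) (recovers P M))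
  coords-configOf : ∀ x → (inc⁻¹ (core (configOf x)) , charge (configOf x)) ≡ x
  coords-configOf (G , d) = cong₂ _,_
    (trans (cong inc⁻¹ (trans (core-σ^ (d ℤ.- + length G) (inc G , [])) (dropZeros-id (inc G) (inc-canonical G))))
           (inc⁻¹-inc G))
    (configOf-charge G d)

-- Since ρ is σ-invariant, the weight of configOf (G, d) is
-- (setSum G + |G| - binom(|G|, 2)) + binom2 d.
configOf-weight : ∀ G d → + weight (configOf (G , d)) ≡ + (setSum G + length G) ℤ.- + (length G choose 2) ℤ.+ binom2 d
configOf-weight G d = begin
  + weight c                   ≡⟨ L (+ weight c) (binom2 (charge c)) ⟩
  ρ c ℤ.+ binom2 (charge c)    ≡⟨ cong₂ ℤ._+_ (σ^-ρ (d ℤ.- + length G) (inc G , [])) (cong binom2 (configOf-charge G d)) ⟩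
  ρ (inc G , []) ℤ.+ binom2 d  ≡⟨ cong (ℤ._+ binom2 d) ρ-base ⟩
  + (setSum G + length G) ℤ.- + (length G choose 2) ℤ.+ binom2 d ∎
  where
  open ≡-Reasoning
  c = configOf (G , d)
  L : ∀ (x y : ℤ) → x ≡ (x ℤ.- y) ℤ.+ y
  L = solve-∀
  ρ-base : ρ (inc G , []) ≡ + (setSum G + length G) ℤ.- + (length G choose 2)
  ρ-base = cong₂ (λ a b → + a ℤ.- binom2 b)
    (trans (ℕP.+-identityʳ _) (trans (ℕP.+-identityʳ _) (setSum-inc G)))
    (trans (ℤP.+-identityʳ (+ length (inc G))) (cong +_ (length-inc G)))

Strict : Set
Strict = Σ (List ℕ) (Linked _>_)

Linked>-irrelevant : ∀ {xs} (p q : Linked _>_ xs) → p ≡ q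
Linked>-irrelevant = Lk.irrelevant ℕP.≤-irrelevant

-- `descending D` decodes a reversed gap code D = (g_k, …, g₁) into the
-- elements (x_k, …, x₁) of the set, largest first; `gapsOf` is its inverse.
descending : List ℕ → List ℕ
descending [] = []
descending (d ∷ ds) = (d + length ds + sum ds) ∷ descending ds

gapsOf : List ℕ → List ℕ
gapsOf [] = []
gapsOf (x ∷ []) = x ∷ []
gapsOf (x ∷ y ∷ xs) = (x ∸ y ∸ 1) ∷ gapsOf (y ∷ xs)

length-descending : ∀ D → length (descending D) ≡ length D
length-descending [] = refl
length-descending (d ∷ D) = cong suc (length-descending D)

length-gapsOf : ∀ xs → length (gapsOf xs) ≡ length xs
length-gapsOf [] = refl
length-gapsOf (x ∷ []) = refl
length-gapsOf (x ∷ y ∷ xs) = cong suc (length-gapsOf (y ∷ xs))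

descending-strict : ∀ D → Linked _>_ (descending D)
descending-strict [] = []
descending-strict (d ∷ []) = [-]
descending-strict (d ∷ d′ ∷ D) = gap ∷ descending-strict (d′ ∷ D)
  where
  gap : d + suc (length D) + (d′ + sum D) > d′ + length D + sum D
  gap = ℕP.≤-trans (ℕP.≤-reflexive (L d′ (length D) (sum D)))
          (ℕP.≤-trans (ℕP.m≤n+m _ d) (ℕP.≤-reflexive (sym (ℕP.+-assoc d (suc (length D)) (d′ + sum D)))))
    where
    L : ∀ a l s → suc (a + l + s) ≡ suc l + (a + s)
    L = solve-∀ℕ

gap-+ : ∀ x y → x > y → (x ∸ y ∸ 1) + suc y ≡ x
gap-+ x y x>y = trans (cong (_+ suc y) (trans (ℕP.∸-+-assoc x y 1) (cong (x ∸_) (ℕP.+-comm y 1)))) (ℕP.m∸n+n≡m x>y)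

gapsOf-top : ∀ x xs → Linked _>_ (x ∷ xs) → sum (gapsOf (x ∷ xs)) + length xs ≡ x
gapsOf-top x [] _ = trans (ℕP.+-identityʳ _) (ℕP.+-identityʳ x)
gapsOf-top x (y ∷ xs) (x>y ∷ l) = begin
  (x ∸ y ∸ 1) + sum (gapsOf (y ∷ xs)) + suc (length xs)  ≡⟨ L (x ∸ y ∸ 1) (sum (gapsOf (y ∷ xs))) (length xs) ⟩
  (x ∸ y ∸ 1) + suc (sum (gapsOf (y ∷ xs)) + length xs)  ≡⟨ cong (λ z → (x ∸ y ∸ 1) + suc z) (gapsOf-top y xs l) ⟩
  (x ∸ y ∸ 1) + suc y                                    ≡⟨ gap-+ x y x>y ⟩
  x ∎
  where
  open ≡-Reasoning
  L : ∀ a b c → a + b + suc c ≡ a + suc (b + c)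
  L = solve-∀ℕ

descending-gapsOf : ∀ xs → Linked _>_ xs → descending (gapsOf xs) ≡ xs
descending-gapsOf [] _ = refl
descending-gapsOf (x ∷ []) _ = cong (_∷ []) (trans (ℕP.+-identityʳ _) (ℕP.+-identityʳ x))
descending-gapsOf (x ∷ y ∷ xs) (x>y ∷ l) = cong₂ _∷_ head (descending-gapsOf (y ∷ xs) l)
  where
  open ≡-Reasoning
  L : ∀ a b c → a + suc (b + c) ≡ a + suc c + b
  L = solve-∀ℕ
  head : (x ∸ y ∸ 1) + length (gapsOf (y ∷ xs)) + sum (gapsOf (y ∷ xs)) ≡ x
  head = begin
    (x ∸ y ∸ 1) + length (gapsOf (y ∷ xs)) + sum (gapsOf (y ∷ xs))
      ≡⟨ cong (λ z → (x ∸ y ∸ 1) + z + sum (gapsOf (y ∷ xs))) (length-gapsOf (y ∷ xs)) ⟩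
    (x ∸ y ∸ 1) + suc (length xs) + sum (gapsOf (y ∷ xs))
      ≡⟨ sym (L (x ∸ y ∸ 1) (sum (gapsOf (y ∷ xs))) (length xs)) ⟩
    (x ∸ y ∸ 1) + suc (sum (gapsOf (y ∷ xs)) + length xs)
      ≡⟨ cong (λ z → (x ∸ y ∸ 1) + suc z) (gapsOf-top y xs l) ⟩
    (x ∸ y ∸ 1) + suc y
      ≡⟨ gap-+ x y x>y ⟩
    x ∎

gapsOf-descending : ∀ D → gapsOf (descending D) ≡ D
gapsOf-descending [] = refl
gapsOf-descending (d ∷ []) = cong (_∷ []) (trans (ℕP.+-identityʳ _) (ℕP.+-identityʳ d))
gapsOf-descending (d ∷ d′ ∷ D) = cong₂ _∷_ head (gapsOf-descending (d′ ∷ D))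
  where
  L : ∀ d a l s → d + suc l + (a + s) ≡ suc d + (a + l + s)
  L = solve-∀ℕ
  head : (d + suc (length D) + (d′ + sum D)) ∸ (d′ + length D + sum D) ∸ 1 ≡ d
  head = trans (cong (λ z → z ∸ (d′ + length D + sum D) ∸ 1) (L d d′ (length D) (sum D)))
    (cong (_∸ 1) (ℕP.m+n∸n≡m (suc d) (d′ + length D + sum D)))

-- setSum on a reversed code: appending a gap at the top adds one element,
-- namely the sum of all gaps plus the number of earlier elements.
setSum-snoc : ∀ G x → setSum (G ∷ʳ x) ≡ setSum G + (sum G + length G + x)
setSum-snoc [] x = L x
  where
  L : ∀ x → x * 1 + 0 + 0 ≡ 0 + (0 + 0 + x)
  L = solve-∀ℕ
setSum-snoc (g ∷ G) x rewrite LP.length-++ G {x ∷ []} | setSum-snoc G x = L g (length G) (setSum G) (sum G) x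
  where
  L : ∀ g l s u x → g * suc (l + 1) + (l + 1) + (s + (u + l + x)) ≡ g * suc l + l + s + (g + u + suc l + x)
  L = solve-∀ℕ

setSum-reverse : ∀ D → setSum (reverse D) ≡ sum (descending D)
setSum-reverse [] = refl
setSum-reverse (d ∷ D)
  rewrite LP.unfold-reverse d D | setSum-snoc (reverse D) d | sum-↭ (↭-reverse D) | LP.length-reverse D | setSum-reverse D
  = L (sum (descending D)) (sum D) (length D) d
  where
  L : ∀ s u l d → s + (u + l + d) ≡ d + l + u + s
  L = solve-∀ℕ

Gaps↔Strict : List ℕ ↔ Strict
Gaps↔Strict = mk↔ₛ′ (λ G → descending (reverse G) , descending-strict (reverse G))
  (λ (xs , l) → reverse (gapsOf xs))
  (λ (xs , l) → Σ-≡ Linked>-irrelevant (trans (cong descending (LP.reverse-involutive (gapsOf xs))) (descending-gapsOf xs l)))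
  (λ G → trans (cong reverse (gapsOf-descending (reverse G))) (LP.reverse-involutive G))

Gaps↔Strict-sum : ∀ G → sum (proj₁ (to Gaps↔Strict G)) ≡ setSum G
Gaps↔Strict-sum G = trans (sym (setSum-reverse (reverse G))) (cong setSum (LP.reverse-involutive G))

Gaps↔Strict-length : ∀ G → length (proj₁ (to Gaps↔Strict G)) ≡ length G
Gaps↔Strict-length G = trans (length-descending (reverse G)) (LP.length-reverse G)

-- Partitions and the Jacobi triple product bijection Φ

-- A partition λ₁ ≥ … ≥ λ_k > 0 is coded by its differences
-- (λ₁ - λ₂, …, λ_{k-1} - λ_k, λ_k - 1); every list of naturals arises.
partFromGaps : List ℕ → List ℕ
partFromGaps [] = []
partFromGaps (e ∷ es) = suc (e + sum es) ∷ partFromGaps es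

partGaps : List ℕ → List ℕ
partGaps [] = []
partGaps (x ∷ []) = (x ∸ 1) ∷ []
partGaps (x ∷ y ∷ xs) = (x ∸ y) ∷ partGaps (y ∷ xs)

partFromGaps-decreasing : ∀ E → Linked _≥_ (partFromGaps E)
partFromGaps-decreasing [] = []
partFromGaps-decreasing (e ∷ []) = [-]
partFromGaps-decreasing (e ∷ e′ ∷ E) = s≤s (ℕP.m≤n+m _ e) ∷ partFromGaps-decreasing (e′ ∷ E)

partFromGaps-positive : ∀ E → All (0 <_) (partFromGaps E)
partFromGaps-positive [] = []
partFromGaps-positive (e ∷ E) = s≤s z≤n ∷ partFromGaps-positive E

partGaps-top : ∀ x xs → Linked _≥_ (x ∷ xs) → All (0 <_) (x ∷ xs) → suc (sum (partGaps (x ∷ xs))) ≡ x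
partGaps-top (suc x) [] _ _ = cong suc (ℕP.+-identityʳ x)
partGaps-top x (y ∷ xs) (x≥y ∷ l) (_ ∷ pos) =
  trans (sym (ℕP.+-suc (x ∸ y) _)) (trans (cong ((x ∸ y) ℕ.+_) (partGaps-top y xs l pos)) (ℕP.m∸n+n≡m x≥y))

partFromGaps-partGaps : ∀ xs → Linked _≥_ xs → All (0 <_) xs → partFromGaps (partGaps xs) ≡ xs
partFromGaps-partGaps [] _ _ = refl
partFromGaps-partGaps (x ∷ []) l pos = cong (_∷ []) (partGaps-top x [] l pos)
partFromGaps-partGaps (x ∷ y ∷ xs) l@(_ ∷ l′) pos@(_ ∷ pos′) =
  cong₂ _∷_ (partGaps-top x (y ∷ xs) l pos) (partFromGaps-partGaps (y ∷ xs) l′ pos′)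

partGaps-partFromGaps : ∀ E → partGaps (partFromGaps E) ≡ E
partGaps-partFromGaps [] = refl
partGaps-partFromGaps (e ∷ []) = cong (_∷ []) (ℕP.+-identityʳ e)
partGaps-partFromGaps (e ∷ e′ ∷ E) = cong₂ _∷_ (ℕP.m+n∸n≡m e (e′ + sum E)) (partGaps-partFromGaps (e′ ∷ E))

Partition-≡ : ∀ {a b : Partition} → Partition.parts a ≡ Partition.parts b → a ≡ b
Partition-≡ {mkPartition xs l p} {mkPartition .xs l′ p′} refl =
  cong₂ (mkPartition xs) (Lk.irrelevant ℕP.≤-irrelevant l l′) (All.irrelevant ℕP.≤-irrelevant p p′)

Partition↔Gaps : Partition ↔ List ℕ
Partition↔Gaps = mk↔ₛ′ (λ μ → partGaps (Partition.parts μ))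
  (λ E → mkPartition (partFromGaps E) (partFromGaps-decreasing E) (partFromGaps-positive E))
  partGaps-partFromGaps
  (λ μ → Partition-≡ (partFromGaps-partGaps _ (Partition.weakDecr μ) (Partition.positive μ)))

-- Reading the same code E as the (reversed) gap code of a set of k = |E|
-- elements: the set's sum plus k is the partition's size plus binom(k, 2).
size-lemma : ∀ E → sum (descending E) + length E ≡ sum (partFromGaps E) + (length E choose 2)
size-lemma [] = refl
size-lemma (e ∷ E) rewrite choose2-suc (length E) = begin
  e + length E + sum E + sum (descending E) + suc (length E)
     ≡⟨ L₁ e (length E) (sum E) (sum (descending E)) ⟩
  suc (e + sum E + length E + (sum (descending E) + length E))
     ≡⟨ cong (λ z → suc (e + sum E + length E + z)) (size-lemma E) ⟩
  suc (e + sum E + length E + (sum (partFromGaps E) + (length E choose 2)))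
     ≡⟨ L₂ e (sum E) (length E) (sum (partFromGaps E)) (length E choose 2) ⟩
  suc (e + sum E) + sum (partFromGaps E) + ((length E choose 2) + length E) ∎
  where
  open ≡-Reasoning
  L₁ : ∀ e l s t → e + l + s + t + suc l ≡ suc (e + s + l + (t + l))
  L₁ = solve-∀ℕ
  L₂ : ∀ e s l p c → suc (e + s + l + (p + c)) ≡ suc (e + s) + p + (c + l)
  L₂ = solve-∀ℕ

Φ : (Partition × ℤ) ↔ Config
Φ = ((Partition↔Gaps ⊙ mk↔ₛ′ reverse reverse LP.reverse-involutive LP.reverse-involutive) ×-↔ ↔-refl) ⊙ coordinates

Φ-charge : ∀ x → charge (to Φ x) ≡ proj₂ x
Φ-charge (μ , d) = configOf-charge _ d

Φ-weight : ∀ x → + weight (to Φ x) ≡ + ∣ proj₁ x ∣ₚ ℤ.+ binom2 (proj₂ x)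
Φ-weight (μ , d) = trans (configOf-weight G d) (cong (ℤ._+ binom2 d) size)
  where
  E = partGaps (Partition.parts μ)
  G = reverse E
  size : + (setSum G + length G) ℤ.- + (length G choose 2) ≡ + ∣ μ ∣ₚ
  size rewrite setSum-reverse E | LP.length-reverse E | size-lemma E
    | partFromGaps-partGaps _ (Partition.weakDecr μ) (Partition.positive μ) =
    trans (cong (ℤ._- + (length E choose 2)) (ℤP.pos-+ _ (length E choose 2)))
      (L (+ ∣ μ ∣ₚ) (+ (length E choose 2)))
    where
    L : ∀ (x y : ℤ) → (x ℤ.+ y) ℤ.- y ≡ x
    L = solve-∀

record Enumeration (Pr : ℕ → Set) : Set where
  field
    value index : ℕ → ℕ
    value-good : ∀ j → 0 < value j × Pr (value j)
    value-index : ∀ k → 0 < k × Pr k → value (index k) ≡ k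
    index-value : ∀ j → index (value j) ≡ j
    value-mono : ∀ {i j} → i > j → value i > value j
    good-irrelevant : ∀ {k} (p q : Pr k) → p ≡ q

Distinct-≡ : ∀ {Pr : ℕ → Set} → (∀ {k} (p q : Pr k) → p ≡ q) → {a b : DistinctIn Pr} →
  DistinctIn.elems a ≡ DistinctIn.elems b → a ≡ b
Distinct-≡ irr {mkDistinct xs l g} {mkDistinct .xs l′ g′} refl =
  cong₂ (mkDistinct xs) (Linked>-irrelevant l l′)
    (All.irrelevant (λ (a , b) (a′ , b′) → cong₂ _,_ (ℕP.≤-irrelevant a a′) (irr b b′)) g g′)

module _ {Pr : ℕ → Set} (V : Enumeration Pr) where
  open Enumeration V

  index-mono : ∀ {k k′} → 0 < k × Pr k → 0 < k′ × Pr k′ → k > k′ → index k > index k′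
  index-mono {k} {k′} gk gk′ k>k′ with ℕP.<-cmp (index k) (index k′)
  ... | tri> _ _ p = p
  ... | tri< p _ _ = ⊥-elim (ℕP.<-asym k>k′ (subst₂ _<_ (value-index k gk) (value-index k′ gk′) (value-mono p)))
  ... | tri≈ _ p _ = ⊥-elim (ℕP.<-irrefl (trans (sym (value-index k′ gk′)) (trans (cong value (sym p)) (value-index k gk))) k>k′)

  private
    linked-value : ∀ js → Linked _>_ js → Linked _>_ (map value js)
    linked-value [] [] = []
    linked-value (j ∷ []) [-] = [-]
    linked-value (i ∷ j ∷ js) (p ∷ l) = value-mono p ∷ linked-value (j ∷ js) l

    all-value : ∀ js → All (λ k → 0 < k × Pr k) (map value js)
    all-value [] = []
    all-value (j ∷ js) = value-good j ∷ all-value js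

    linked-index : ∀ ks → Linked _>_ ks → All (λ k → 0 < k × Pr k) ks → Linked _>_ (map index ks)
    linked-index [] [] _ = []
    linked-index (k ∷ []) [-] _ = [-]
    linked-index (k ∷ k′ ∷ ks) (p ∷ l) (g ∷ g′ ∷ gs) = index-mono g g′ p ∷ linked-index (k′ ∷ ks) l (g′ ∷ gs)

    index∘value : ∀ js → map index (map value js) ≡ js
    index∘value [] = refl
    index∘value (j ∷ js) = cong₂ _∷_ (index-value j) (index∘value js)

    value∘index : ∀ ks → All (λ k → 0 < k × Pr k) ks → map value (map index ks) ≡ ks
    value∘index [] [] = refl
    value∘index (k ∷ ks) (g ∷ gs) = cong₂ _∷_ (value-index k g) (value∘index ks gs)

  Strict↔Distinct : Strict ↔ DistinctIn Pr
  Strict↔Distinct = mk↔ₛ′ (λ (js , l) → mkDistinct (map value js) (linked-value js l) (all-value js))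
    (λ d → map index (DistinctIn.elems d) , linked-index _ (DistinctIn.strDecr d) (DistinctIn.good d))
    (λ d → Distinct-≡ good-irrelevant (value∘index (DistinctIn.elems d) (DistinctIn.good d)))
    (λ (js , l) → Σ-≡ Linked>-irrelevant (index∘value js))

sum-affine : ∀ (α C : ℕ) js → sum (map (λ j → α + j * C) js) ≡ C * sum js + α * length js
sum-affine α C [] = L α C
  where
  L : ∀ α C → 0 ≡ C * 0 + α * 0
  L = solve-∀ℕ
sum-affine α C (j ∷ js) rewrite sum-affine α C js = L α C j (sum js) (length js)
  where
  L : ∀ α C j s l → α + j * C + (C * s + α * l) ≡ C * (j + s) + α * suc l
  L = solve-∀ℕ

∣-irrelevant : ∀ {c n} → 1 ≤ c → (p q : c ℕD.∣ n) → p ≡ q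
∣-irrelevant {suc c} {n} _ (divides a e) (divides b e′) with ℕP.*-cancelʳ-≡ a b (suc c) (trans (sym e) e′)
... | refl = cong (divides a) (ℕP.≡-irrelevant e e′)

∣-∣-≥ : ∀ k A → A ≤ k → ∣ + k ℤ.- + A ∣ ≡ k ∸ A
∣-∣-≥ k A A≤k = cong ∣_∣ (trans (ℤP.m-n≡m⊖n k A) (ℤP.⊖-≥ A≤k))

∣-∣-< : ∀ k A → k < A → ∣ + k ℤ.- + A ∣ ≡ A ∸ k
∣-∣-< k A k<A = trans (cong ∣_∣ (ℤP.m-n≡m⊖n k A)) (ℤP.∣⊖∣-< k<A)

half<C : ∀ {A C} → 1 ≤ C → 2 * A ≤ C → A < C
half<C {A} {C} c≥1 h with A ℕ.<? C
... | yes p = p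
... | no np = ⊥-elim (ℕP.<-irrefl refl (ℕP.<-≤-trans c≥1 C≤0))
  where
  C≤A = ℕP.≮⇒≥ np
  C+C≤C : C + C ≤ C + 0
  C+C≤C = ℕP.≤-trans (ℕP.+-mono-≤ C≤A C≤A)
    (ℕP.≤-trans (ℕP.≤-reflexive (cong (A ℕ.+_) (sym (ℕP.+-identityʳ A)))) (ℕP.≤-trans h (ℕP.≤-reflexive (sym (ℕP.+-identityʳ C)))))
  C≤0 : C ≤ 0
  C≤0 = ℕP.+-cancelˡ-≤ C C 0 C+C≤C

enumPlus : ∀ C A → 1 ≤ A → 2 * A ≤ C → Enumeration (CongPlus C A)
enumPlus zero A A≥1 h = ⊥-elim (ℕP.<-irrefl refl (ℕP.≤-trans (ℕP.≤-trans A≥1 (ℕP.m≤m+n A (A + 0))) h))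
enumPlus C@(suc c) A A≥1 h = record
  { value = value ; index = index ; value-good = value-good ; value-index = value-index
  ; index-value = index-value ; value-mono = value-mono ; good-irrelevant = ∣-irrelevant (s≤s z≤n) }
  where
  value index : ℕ → ℕ
  value j = A + j * C
  index k = (k ∸ A) / C
  value∸A : ∀ j → value j ∸ A ≡ j * C
  value∸A j = ℕP.m+n∸m≡n A (j * C)
  value-good : ∀ j → 0 < value j × CongPlus C A (value j)
  value-good j = ℕP.≤-trans A≥1 (ℕP.m≤m+n A _) ,
    subst (C ℕD.∣_) (sym (trans (∣-∣-≥ (value j) A (ℕP.m≤m+n A _)) (value∸A j))) (divides j refl)
  value-index : ∀ k → 0 < k × CongPlus C A k → value (index k) ≡ k
  value-index k (k>0 , d) with A ≤? k
  ... | yes A≤k = trans (cong (A ℕ.+_) (m/n*n≡m (subst (C ℕD.∣_) (∣-∣-≥ k A A≤k) d))) (ℕP.m+[n∸m]≡n A≤k)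
  ... | no A≰k = ⊥-elim (ℕP.<-irrefl refl (ℕP.≤-<-trans (ℕP.≤-trans (∣⇒≤ {{nz}} C∣A∸k) (ℕP.m∸n≤m A k)) (half<C (s≤s z≤n) h)))
    where
    k<A = ℕP.≰⇒> A≰k
    C∣A∸k = subst (C ℕD.∣_) (∣-∣-< k A k<A) d
    nz : NonZero (A ∸ k)
    nz = ℕ.>-nonZero (ℕP.m<n⇒0<n∸m k<A)
  index-value : ∀ j → index (value j) ≡ j
  index-value j = trans (cong (_/ C) (value∸A j)) (m*n/n≡m j C)
  value-mono : ∀ {i j} → i > j → value i > value j
  value-mono p = ℕP.+-monoʳ-< A (ℕP.*-monoˡ-< C p)

enumMinus : ∀ C A → 1 ≤ C → 2 * A ≤ C → Enumeration (CongMinus C A)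
enumMinus C@(suc c) A C≥1 h = record
  { value = value ; index = index ; value-good = value-good ; value-index = value-index
  ; index-value = index-value ; value-mono = value-mono ; good-irrelevant = ∣-irrelevant (s≤s z≤n) }
  where
  C∸A+A : (C ∸ A) + A ≡ C
  C∸A+A = ℕP.m∸n+n≡m (ℕP.<⇒≤ (half<C {A} {C} C≥1 h))
  value index : ℕ → ℕ
  value j = (C ∸ A) + j * C
  index k = (k + A) / C ∸ 1
  value+A : ∀ j → value j + A ≡ suc j * C
  value+A j = trans (L (C ∸ A) (j * C) A) (cong (_+ j * C) C∸A+A)
    where
    L : ∀ a b c → a + b + c ≡ a + c + b
    L = solve-∀ℕ
  value-good : ∀ j → 0 < value j × CongMinus C A (value j)
  value-good j = ℕP.≤-trans (ℕP.m<n⇒0<n∸m (half<C {A} {C} C≥1 h)) (ℕP.m≤m+n (C ∸ A) (j * C)) ,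
    subst (C ℕD.∣_) (sym (value+A j)) (divides (suc j) refl)
  value-index : ∀ k → 0 < k × CongMinus C A k → value (index k) ≡ k
  value-index k (k>0 , d) with (k + A) / C | m/n*n≡m {k + A} {C} d
  ... | zero | e = ⊥-elim (ℕP.<-irrefl refl (ℕP.≤-trans k>0 (ℕP.≤-trans (ℕP.m≤m+n k A) (ℕP.≤-reflexive (sym e)))))
  ... | suc q | e = ℕP.+-cancelʳ-≡ A (value q) k (trans (value+A q) e)
  index-value : ∀ j → index (value j) ≡ j
  index-value j = cong (_∸ 1) (trans (cong (_/ C) (value+A j)) (m*n/n≡m (suc j) C))
  value-mono : ∀ {i j} → i > j → value i > value j
  value-mono p = ℕP.+-monoʳ-< (C ∸ A) (ℕP.*-monoˡ-< C p)

-- One factor: Partition × ℤ versus pairs of sets of distinct parts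

-- The extra datum recorded when A = 0: whether 0 belongs to P.
Extra : Bool → Set
Extra true = Bool
Extra false = ⊤

extraCount : ∀ {b} → Extra b → ℕ
extraCount {true} true = 1
extraCount {true} false = 0
extraCount {false} tt = 0

DistinctPair : ℕ → ℕ → Set
DistinctPair C A = DistinctIn (CongPlus C A) × DistinctIn (CongMinus C A)

sumD : ∀ {P} → DistinctIn P → ℕ
sumD d = sum (DistinctIn.elems d)

lengthD : ∀ {P} → DistinctIn P → ℕ
lengthD d = length (DistinctIn.elems d)

solWeight : ℕ → ℕ → Partition × ℤ → ℤ
solWeight C A (μ , d) = + C ℤ.* + ∣ μ ∣ₚ ℤ.+ + C ℤ.* binom2 d ℤ.+ + A ℤ.* d

record FactorBijection (C A : ℕ) : Set where
  field
    bij : (Partition × ℤ) ↔ (Extra (does (A ℕ.≟ 0)) × DistinctPair C A)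
    bij-weight : ∀ x → solWeight C A x ≡
      + (sumD (proj₁ (proj₂ (to bij x))) + sumD (proj₂ (proj₂ (to bij x))))
    bij-charge : ∀ x → proj₂ x ≡
      + (extraCount (proj₁ (to bij x)) + lengthD (proj₁ (proj₂ (to bij x)))) ℤ.- + lengthD (proj₂ (proj₂ (to bij x)))

module EnumeratedSets {Pr : ℕ → Set} (V : Enumeration Pr) (α C : ℕ)
                      (value-affine : ∀ j → Enumeration.value V j ≡ α + j * C) where
  gaps↔ : List ℕ ↔ DistinctIn Pr
  gaps↔ = Gaps↔Strict ⊙ Strict↔Distinct V

  gaps↔-sum : ∀ G → sumD (to gaps↔ G) ≡ C * setSum G + α * length G
  gaps↔-sum G = trans (cong sum (LP.map-cong value-affine (proj₁ (to Gaps↔Strict G))))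
    (trans (sum-affine α C (proj₁ (to Gaps↔Strict G)))
      (cong₂ (λ a b → C * a + α * b) (Gaps↔Strict-sum G) (Gaps↔Strict-length G)))

  gaps↔-length : ∀ G → lengthD (to gaps↔ G) ≡ length G
  gaps↔-length G = trans (LP.length-map (Enumeration.value V) (proj₁ (to Gaps↔Strict G))) (Gaps↔Strict-length G)

enumPlus-value : ∀ C A A≥1 h j → Enumeration.value (enumPlus C A A≥1 h) j ≡ A + j * C
enumPlus-value zero A A≥1 h = ⊥-elim (ℕP.<-irrefl refl (ℕP.≤-trans (ℕP.≤-trans A≥1 (ℕP.m≤m+n A (A + 0))) h))
enumPlus-value (suc c) A A≥1 h j = refl

enumMinus-value : ∀ C A C≥1 h j → Enumeration.value (enumMinus C A C≥1 h) j ≡ (C ∸ A) + j * C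
enumMinus-value (suc c) A C≥1 h j = refl

pos-+-* : ∀ a b c d → + (a * b + c * d) ≡ + a ℤ.* + b ℤ.+ + c ℤ.* + d
pos-+-* a b c d = trans (ℤP.pos-+ (a * b) (c * d)) (cong₂ ℤ._+_ (ℤP.pos-* a b) (ℤP.pos-* c d))

factor-pos : ∀ C a → 1 ≤ C → 2 * suc a ≤ C → FactorBijection C (suc a)
factor-pos C a C≥1 h = record { bij = bij ; bij-weight = bij-weight ; bij-charge = bij-charge }
  where
  A = suc a
  module S⁺ = EnumeratedSets (enumPlus C A (s≤s z≤n) h) A C (enumPlus-value C A (s≤s z≤n) h)
  module S⁻ = EnumeratedSets (enumMinus C A C≥1 h) (C ∸ A) C (enumMinus-value C A C≥1 h)
  bij : (Partition × ℤ) ↔ (⊤ × DistinctPair C A)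
  bij = Φ ⊙ mk↔ₛ′ (tt ,_) proj₂ (λ _ → refl) (λ _ → refl) ⊙ (↔-refl ×-↔ (S⁺.gaps↔ ×-↔ S⁻.gaps↔))
  C-A : + C ℤ.- + A ≡ + (C ∸ A)
  C-A = trans (ℤP.m-n≡m⊖n C A) (ℤP.⊖-≥ (ℕP.<⇒≤ (half<C {A} {C} C≥1 h)))
  bij-weight : ∀ x → solWeight C A x ≡ + (sumD (proj₁ (proj₂ (to bij x))) + sumD (proj₂ (proj₂ (to bij x))))
  bij-weight x@(μ , d) = begin
    + C ℤ.* + ∣ μ ∣ₚ ℤ.+ + C ℤ.* binom2 d ℤ.+ + A ℤ.* d
      ≡⟨ L₁ (+ C) (+ A) (+ ∣ μ ∣ₚ) (binom2 d) d ⟩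
    + C ℤ.* (+ ∣ μ ∣ₚ ℤ.+ binom2 d) ℤ.+ + A ℤ.* d
      ≡⟨ cong₂ (λ u w → + C ℤ.* u ℤ.+ + A ℤ.* w) (sym (Φ-weight x)) (sym (Φ-charge x)) ⟩
    + C ℤ.* + weight (P , M) ℤ.+ + A ℤ.* (+ length P ℤ.- + length M)
      ≡⟨ L₂ (+ C) (+ A) (+ setSum P) (+ setSum M) (+ length P) (+ length M) ⟩
    (+ C ℤ.* + setSum P ℤ.+ + A ℤ.* + length P) ℤ.+ (+ C ℤ.* + setSum M ℤ.+ (+ C ℤ.- + A) ℤ.* + length M)
      ≡⟨ cong₂ ℤ._+_ (sym (pos-+-* C (setSum P) A (length P)))
                     (trans (cong (λ z → + C ℤ.* + setSum M ℤ.+ z ℤ.* + length M) C-A) (sym (pos-+-* C (setSum M) (C ∸ A) (length M)))) ⟩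
    + (C * setSum P + A * length P) ℤ.+ + (C * setSum M + (C ∸ A) * length M)
      ≡⟨ cong₂ (λ u w → + u ℤ.+ + w) (sym (S⁺.gaps↔-sum P)) (sym (S⁻.gaps↔-sum M)) ⟩
    + sumD (to S⁺.gaps↔ P) ℤ.+ + sumD (to S⁻.gaps↔ M)
      ≡⟨ sym (ℤP.pos-+ (sumD (to S⁺.gaps↔ P)) (sumD (to S⁻.gaps↔ M))) ⟩
    + (sumD (to S⁺.gaps↔ P) + sumD (to S⁻.gaps↔ M)) ∎
    where
    open ≡-Reasoning
    P = proj₁ (to Φ x)
    M = proj₂ (to Φ x)
    L₁ : ∀ (C A l b d : ℤ) → C ℤ.* l ℤ.+ C ℤ.* b ℤ.+ A ℤ.* d ≡ C ℤ.* (l ℤ.+ b) ℤ.+ A ℤ.* d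
    L₁ = solve-∀
    L₂ : ∀ (C A s t p m : ℤ) → C ℤ.* (s ℤ.+ t ℤ.+ m) ℤ.+ A ℤ.* (p ℤ.- m) ≡ (C ℤ.* s ℤ.+ A ℤ.* p) ℤ.+ (C ℤ.* t ℤ.+ (C ℤ.- A) ℤ.* m)
    L₂ = solve-∀
  bij-charge : ∀ x → proj₂ x ≡ + (0 + lengthD (proj₁ (proj₂ (to bij x)))) ℤ.- + lengthD (proj₂ (proj₂ (to bij x)))
  bij-charge x = trans (sym (Φ-charge x))
    (cong₂ (λ u w → + u ℤ.- + w) (sym (S⁺.gaps↔-length (proj₁ (to Φ x)))) (sym (S⁻.gaps↔-length (proj₂ (to Φ x)))))

splitZero : List ℕ ↔ (Bool × List ℕ)
splitZero = mk↔ₛ′ split join split-join join-split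
  where
  split : List ℕ → Bool × List ℕ
  split [] = false , []
  split (zero ∷ G) = true , G
  split (suc g ∷ G) = false , g ∷ G
  join : Bool × List ℕ → List ℕ
  join (true , G) = 0 ∷ G
  join (false , G) = inc G
  split-join : ∀ y → split (join y) ≡ y
  split-join (true , G) = refl
  split-join (false , []) = refl
  split-join (false , g ∷ G) = refl
  join-split : ∀ x → join (split x) ≡ x
  join-split [] = refl
  join-split (zero ∷ G) = refl
  join-split (suc g ∷ G) = refl

splitZero-sum : ∀ P → setSum P ≡ setSum (proj₂ (to splitZero P)) + length (proj₂ (to splitZero P))
splitZero-sum [] = refl
splitZero-sum (zero ∷ G) = ℕP.+-comm (length G) (setSum G)
splitZero-sum (suc g ∷ G) = setSum-inc (g ∷ G)

splitZero-length : ∀ P → length P ≡ extraCount {true} (proj₁ (to splitZero P)) + length (proj₂ (to splitZero P))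
splitZero-length [] = refl
splitZero-length (zero ∷ G) = refl
splitZero-length (suc g ∷ G) = refl

-- A = 0: 0 ∈ P becomes the extra bit, the rest of P and all of M go to
-- C + jC (both residue classes are 0 mod C).
factor-zero : ∀ C → 1 ≤ C → 2 * 0 ≤ C → FactorBijection C 0
factor-zero C C≥1 h = record { bij = bij ; bij-weight = bij-weight ; bij-charge = bij-charge }
  where
  module S = EnumeratedSets (enumMinus C 0 C≥1 h) C C (enumMinus-value C 0 C≥1 h)
  bij : (Partition × ℤ) ↔ (Bool × DistinctPair C 0)
  bij = Φ ⊙ (splitZero ×-↔ ↔-refl)
    ⊙ mk↔ₛ′ (λ ((b , p) , m) → b , (p , m)) (λ (b , (p , m)) → (b , p) , m) (λ _ → refl) (λ _ → refl)
    ⊙ (↔-refl ×-↔ (S.gaps↔ ×-↔ S.gaps↔))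
  bij-weight : ∀ x → solWeight C 0 x ≡ + (sumD (proj₁ (proj₂ (to bij x))) + sumD (proj₂ (proj₂ (to bij x))))
  bij-weight x@(μ , d) = begin
    + C ℤ.* + ∣ μ ∣ₚ ℤ.+ + C ℤ.* binom2 d ℤ.+ + 0 ℤ.* d
      ≡⟨ L₁ (+ C) (+ ∣ μ ∣ₚ) (binom2 d) d ⟩
    + C ℤ.* (+ ∣ μ ∣ₚ ℤ.+ binom2 d)
      ≡⟨ cong (+ C ℤ.*_) (sym (Φ-weight x)) ⟩
    + C ℤ.* + weight (P , M)
      ≡⟨ sym (ℤP.pos-* C (weight (P , M))) ⟩
    + (C * (setSum P + setSum M + length M))
      ≡⟨ cong (λ z → + (C * (z + setSum M + length M))) (splitZero-sum P) ⟩
    + (C * (setSum P′ + length P′ + setSum M + length M))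
      ≡⟨ cong +_ (L₂ C (setSum P′) (length P′) (setSum M) (length M)) ⟩
    + (C * setSum P′ + C * length P′ + (C * setSum M + C * length M))
      ≡⟨ cong₂ (λ u w → + (u + w)) (sym (S.gaps↔-sum P′)) (sym (S.gaps↔-sum M)) ⟩
    + (sumD (to S.gaps↔ P′) + sumD (to S.gaps↔ M)) ∎
    where
    open ≡-Reasoning
    P = proj₁ (to Φ x)
    M = proj₂ (to Φ x)
    P′ = proj₂ (to splitZero P)
    L₁ : ∀ (C l b d : ℤ) → C ℤ.* l ℤ.+ C ℤ.* b ℤ.+ + 0 ℤ.* d ≡ C ℤ.* (l ℤ.+ b)
    L₁ = solve-∀
    L₂ : ∀ C s l t m → C * (s + l + t + m) ≡ C * s + C * l + (C * t + C * m)
    L₂ = solve-∀ℕ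
  bij-charge : ∀ x → proj₂ x ≡ + (extraCount (proj₁ (to bij x)) + lengthD (proj₁ (proj₂ (to bij x)))) ℤ.- + lengthD (proj₂ (proj₂ (to bij x)))
  bij-charge x = trans (sym (Φ-charge x)) (cong₂ (λ u w → + u ℤ.- + w)
    (trans (splitZero-length P) (cong (ℕ._+_ (extraCount {true} (proj₁ (to splitZero P)))) (sym (S.gaps↔-length (proj₂ (to splitZero P))))))
    (sym (S.gaps↔-length (proj₂ (to Φ x)))))
    where
    P = proj₁ (to Φ x)

factor : ∀ C A → 1 ≤ C → 2 * A ≤ C → FactorBijection C A
factor C zero = factor-zero C
factor C (suc a) = factor-pos C a

Σℤ-ext : ∀ {n} {f g : Fin n → ℤ} → (∀ i → f i ≡ g i) → Σℤ f ≡ Σℤ g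
Σℤ-ext {zero} h = refl
Σℤ-ext {suc n} h = cong₂ ℤ._+_ (h zero) (Σℤ-ext (λ i → h (suc i)))

Σℕ-ext : ∀ {n} {f g : Fin n → ℕ} → (∀ i → f i ≡ g i) → Σℕ f ≡ Σℕ g
Σℕ-ext {zero} h = refl
Σℕ-ext {suc n} h = cong₂ _+_ (h zero) (Σℕ-ext (λ i → h (suc i)))

Σℤ-+ : ∀ {n} (f g : Fin n → ℤ) → Σℤ (λ i → f i ℤ.+ g i) ≡ Σℤ f ℤ.+ Σℤ g
Σℤ-+ {zero} f g = refl
Σℤ-+ {suc n} f g = trans (cong (ℤ._+_ (f zero ℤ.+ g zero)) (Σℤ-+ (λ i → f (suc i)) (λ i → g (suc i))))
  (L (f zero) (g zero) _ _)
  where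
  L : ∀ (a b c d : ℤ) → (a ℤ.+ b) ℤ.+ (c ℤ.+ d) ≡ (a ℤ.+ c) ℤ.+ (b ℤ.+ d)
  L = solve-∀

Σℕ-+ : ∀ {n} (f g : Fin n → ℕ) → Σℕ (λ i → f i + g i) ≡ Σℕ f + Σℕ g
Σℕ-+ {zero} f g = refl
Σℕ-+ {suc n} f g rewrite Σℕ-+ (λ i → f (suc i)) (λ i → g (suc i)) = L (f zero) (g zero) _ _
  where
  L : ∀ a b c d → (a + b) + (c + d) ≡ (a + c) + (b + d)
  L = solve-∀ℕ

Σℤ-pos : ∀ {n} (f : Fin n → ℕ) → Σℤ (λ i → + f i) ≡ + Σℕ f
Σℤ-pos {zero} f = refl
Σℤ-pos {suc n} f = trans (cong (ℤ._+_ (+ f zero)) (Σℤ-pos (λ i → f (suc i)))) (sym (ℤP.pos-+ (f zero) _))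

Σℤ-sub : ∀ {n} (f g : Fin n → ℕ) → Σℤ (λ i → + f i ℤ.- + g i) ≡ + Σℕ f ℤ.- + Σℕ g
Σℤ-sub {zero} f g = refl
Σℤ-sub {suc n} f g = trans (cong (ℤ._+_ (+ f zero ℤ.- + g zero)) (Σℤ-sub (λ i → f (suc i)) (λ i → g (suc i))))
  (trans (L (+ f zero) (+ g zero) (+ Σℕ (λ i → f (suc i))) (+ Σℕ (λ i → g (suc i))))
    (sym (cong₂ ℤ._-_ (ℤP.pos-+ (f zero) _) (ℤP.pos-+ (g zero) _))))
  where
  L : ∀ (a b c d : ℤ) → (a ℤ.- b) ℤ.+ (c ℤ.- d) ≡ (a ℤ.+ c) ℤ.- (b ℤ.+ d)
  L = solve-∀

Tuple-map : ∀ {t} {F G : Fin t → Set} → (∀ i → F i ↔ G i) → Tuple t F ↔ Tuple t G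
Tuple-map {zero} K = ↔-refl
Tuple-map {suc t} K = K zero ×-↔ Tuple-map (λ i → K (suc i))

get-map : ∀ {t} {F G : Fin t → Set} (K : ∀ i → F i ↔ G i) x i → get (to (Tuple-map K) x) i ≡ to (K i) (get x i)
get-map {suc t} K x zero = refl
get-map {suc t} K x (suc i) = get-map (λ i → K (suc i)) (proj₂ x) i

Vec²↔Tuple : ∀ {t} {X Y : Set} → (Vec X t × Vec Y t) ↔ Tuple t (λ _ → X × Y)
Vec²↔Tuple {zero} = mk↔ₛ′ (λ _ → tt) (λ _ → [] , []) (λ _ → refl) (λ { ([] , []) → refl })
Vec²↔Tuple {suc t} = mk↔ₛ′ (λ { (x ∷ μ , y ∷ d) → (x , y) , to Vec²↔Tuple (μ , d) })
  (λ { ((x , y) , r) → (x ∷ proj₁ (from Vec²↔Tuple r)) , (y ∷ proj₂ (from Vec²↔Tuple r)) })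
  (λ { ((x , y) , r) → cong ((x , y) ,_) (to-from Vec²↔Tuple r) })
  (λ { (x ∷ μ , y ∷ d) → cong₂ (λ a b → (x ∷ a) , (y ∷ b))
       (cong proj₁ (from-to Vec²↔Tuple (μ , d))) (cong proj₂ (from-to Vec²↔Tuple (μ , d))) })

get-Vec²↔Tuple : ∀ {t} {X Y : Set} (μ : Vec X t) (d : Vec Y t) i → get (to Vec²↔Tuple (μ , d)) i ≡ (lookup μ i , lookup d i)
get-Vec²↔Tuple (x ∷ μ) (y ∷ d) zero = refl
get-Vec²↔Tuple (x ∷ μ) (y ∷ d) (suc i) = get-Vec²↔Tuple μ d i

Tuple-split : ∀ {t} {F G : Fin t → Set} → Tuple t (λ i → F i × G i) ↔ (Tuple t F × Tuple t G)
Tuple-split {zero} = mk↔ₛ′ (λ _ → tt , tt) (λ _ → tt) (λ _ → refl) (λ _ → refl)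
Tuple-split {suc t} = mk↔ₛ′ (λ ((a , b) , r) → (a , proj₁ (to Tuple-split r)) , (b , proj₂ (to Tuple-split r)))
  (λ ((a , r) , (b , s)) → (a , b) , from Tuple-split (r , s))
  (λ ((a , r) , (b , s)) → cong₂ (λ u w → (a , u) , (b , w))
     (cong proj₁ (to-from Tuple-split (r , s))) (cong proj₂ (to-from Tuple-split (r , s))))
  (λ ((a , b) , r) → cong ((a , b) ,_) (from-to Tuple-split r))

get-split₁ : ∀ {t} {F G : Fin t → Set} (x : Tuple t (λ i → F i × G i)) i →
  get (proj₁ (to (Tuple-split {t} {F} {G}) x)) i ≡ proj₁ (get x i)
get-split₁ {suc t} x zero = refl
get-split₁ {suc t} x (suc i) = get-split₁ (proj₂ x) i

get-split₂ : ∀ {t} {F G : Fin t → Set} (x : Tuple t (λ i → F i × G i)) i →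
  get (proj₂ (to (Tuple-split {t} {F} {G}) x)) i ≡ proj₂ (get x i)
get-split₂ {suc t} x zero = refl
get-split₂ {suc t} x (suc i) = get-split₂ (proj₂ x) i

odd : ℕ → Bool
odd zero = false
odd (suc n) = not (odd n)

bit : Bool → ℕ
bit true = 1
bit false = 0

%2≡bit-odd : ∀ n → n % 2 ≡ bit (odd n)
%2≡bit-odd zero = refl
%2≡bit-odd (suc zero) = refl
%2≡bit-odd (suc (suc n)) = begin
  suc (suc n) % 2      ≡⟨ cong (_% 2) (sym (ℕP.+-comm n 2)) ⟩
  (n + 1 * 2) % 2      ≡⟨ [m+kn]%n≡m%n n 1 2 ⟩
  n % 2                ≡⟨ %2≡bit-odd n ⟩
  bit (odd n)          ≡⟨ cong bit (sym (BP.not-involutive (odd n))) ⟩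
  bit (odd (suc (suc n))) ∎
  where open ≡-Reasoning

odd-+ : ∀ m n → odd (m + n) ≡ odd m xor odd n
odd-+ zero n = refl
odd-+ (suc m) n rewrite odd-+ m n = BP.not-distribˡ-xor (odd m) (odd n)

OddNat↔odd : ∀ n → OddNat n ↔ (odd n ≡ true)
OddNat↔odd n = prop-↔ to-odd from-odd ℕP.≡-irrelevant Bool-irrelevant
  where
  to-odd : n % 2 ≡ 1 → odd n ≡ true
  to-odd e with odd n | %2≡bit-odd n
  ... | true | _ = refl
  ... | false | e′ with () ← trans (sym e) e′
  from-odd : odd n ≡ true → n % 2 ≡ 1
  from-odd e = trans (%2≡bit-odd n) (cong bit e)

∣-∣%2 : ∀ a b → ∣ + a ℤ.- + b ∣ % 2 ≡ (a + b) % 2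
∣-∣%2 a b with ℕP.≤-total b a
... | inj₁ b≤a = trans (cong (λ z → ∣ z ∣ % 2) (trans (ℤP.m-n≡m⊖n a b) (ℤP.⊖-≥ b≤a)))
  (trans (sym ([m+kn]%n≡m%n (a ∸ b) b 2)) (cong (_% 2) (∸+2* a b b≤a)))
  where
  ∸+2* : ∀ a b → b ≤ a → a ∸ b + b * 2 ≡ a + b
  ∸+2* a b b≤a = begin
    a ∸ b + b * 2        ≡⟨ cong (a ∸ b ℕ.+_) (ℕP.*-comm b 2) ⟩
    a ∸ b + (b + (b + 0)) ≡⟨ cong (λ z → a ∸ b + (b + z)) (ℕP.+-identityʳ b) ⟩
    a ∸ b + (b + b)       ≡⟨ sym (ℕP.+-assoc (a ∸ b) b b) ⟩
    a ∸ b + b + b         ≡⟨ cong (_+ b) (ℕP.m∸n+n≡m b≤a) ⟩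
    a + b ∎
    where open ≡-Reasoning
... | inj₂ a≤b = trans (cong (_% 2) (trans (cong ∣_∣ (ℤP.m-n≡m⊖n a b)) (ℤP.∣⊖∣-≤ a≤b)))
  (trans (sym ([m+kn]%n≡m%n (b ∸ a) a 2)) (cong (_% 2) (trans (∸+2* b a a≤b) (ℕP.+-comm b a))))
  where
  ∸+2* : ∀ a b → b ≤ a → a ∸ b + b * 2 ≡ a + b
  ∸+2* a b b≤a = begin
    a ∸ b + b * 2        ≡⟨ cong (a ∸ b ℕ.+_) (ℕP.*-comm b 2) ⟩
    a ∸ b + (b + (b + 0)) ≡⟨ cong (λ z → a ∸ b + (b + z)) (ℕP.+-identityʳ b) ⟩
    a ∸ b + (b + b)       ≡⟨ sym (ℕP.+-assoc (a ∸ b) b b) ⟩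
    a ∸ b + b + b         ≡⟨ cong (_+ b) (ℕP.m∸n+n≡m b≤a) ⟩
    a + b ∎
    where open ≡-Reasoning

OddInt-sub : ∀ a b → OddInt (+ a ℤ.- + b) ↔ OddNat (a + b)
OddInt-sub a b = subst (λ z → (z ≡ 1) ↔ ((a + b) % 2 ≡ 1)) (sym (∣-∣%2 a b)) ↔-refl

Extras : ∀ {t} → (Fin t → ℕ) → Set
Extras {t} A = Tuple t (λ i → Extra (does (A i ℕ.≟ 0)))

extraTotal : ∀ {t} {A : Fin t → ℕ} → Extras A → ℕ
extraTotal {A = A} e = Σℕ (λ i → extraCount (get e i))

Extras↔Fin : ∀ {t} (A : Fin t → ℕ) → Extras A ↔ Fin (2 ^ #zeros A)
Extras↔Fin {zero} A = ↔-sym FinP.1↔⊤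
Extras↔Fin {suc t} A with does (A zero ℕ.≟ 0)
... | true = (↔-sym FinP.2↔Bool ×-↔ Extras↔Fin (λ i → A (suc i))) ⊙ ↔-sym (FinP.*↔× {2} {2 ^ #zeros (λ i → A (suc i))})
... | false = mk↔ₛ′ proj₂ (tt ,_) (λ _ → refl) (λ _ → refl) ⊙ Extras↔Fin (λ i → A (suc i))

Extras-trivial : ∀ {t} (A : Fin t → ℕ) → #zeros A ≡ 0 → Extras A ↔ ⊤
Extras-trivial {zero} A _ = ↔-refl
Extras-trivial {suc t} A eq with does (A zero ℕ.≟ 0)
... | false = mk↔ₛ′ proj₂ (tt ,_) (λ _ → refl) (λ _ → refl) ⊙ Extras-trivial (λ i → A (suc i)) eq

extraTotal-trivial : ∀ {t} (A : Fin t → ℕ) → #zeros A ≡ 0 → ∀ e → extraTotal {A = A} e ≡ 0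
extraTotal-trivial {zero} A _ _ = refl
extraTotal-trivial {suc t} A eq with does (A zero ℕ.≟ 0)
... | false = λ e → extraTotal-trivial (λ i → A (suc i)) eq (proj₂ e)

odd-flip-bit : ∀ b → odd (extraCount {true} (not b)) ≡ not (odd (extraCount {true} b))
odd-flip-bit true = refl
odd-flip-bit false = refl

flipFirst : ∀ {t} (A : Fin t → ℕ) → Extras A → Extras A
flipFirst {zero} A e = e
flipFirst {suc t} A with does (A zero ℕ.≟ 0)
... | true = λ (b , r) → not b , r
... | false = λ (u , r) → u , flipFirst (λ i → A (suc i)) r

flipFirst-involutive : ∀ {t} (A : Fin t → ℕ) e → flipFirst A (flipFirst A e) ≡ e
flipFirst-involutive {zero} A e = refl
flipFirst-involutive {suc t} A e with does (A zero ℕ.≟ 0)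
flipFirst-involutive {suc t} A (b , r) | true = cong (_, r) (BP.not-involutive b)
flipFirst-involutive {suc t} A (tt , r) | false = cong (tt ,_) (flipFirst-involutive (λ i → A (suc i)) r)

flipFirst-parity : ∀ {t} (A : Fin t → ℕ) z → #zeros A ≡ suc z →
  ∀ e → odd (extraTotal {A = A} (flipFirst A e)) ≡ not (odd (extraTotal {A = A} e))
flipFirst-parity {zero} A z () e
flipFirst-parity {suc t} A z eq e with does (A zero ℕ.≟ 0)
flipFirst-parity {suc t} A z eq (b , r) | true
  rewrite odd-+ (extraCount {true} (not b)) (extraTotal {A = λ i → A (suc i)} r)
        | odd-+ (extraCount {true} b) (extraTotal {A = λ i → A (suc i)} r)
        | odd-flip-bit b = sym (BP.not-distribˡ-xor (odd (extraCount {true} b)) _)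
flipFirst-parity {suc t} A z eq (tt , r) | false = flipFirst-parity (λ i → A (suc i)) z eq r

halving : ∀ {X : Set} (h : X → Bool) (f : X → X) → (∀ x → f (f x) ≡ x) → (∀ x → h (f x) ≡ not (h x)) →
  (Fin 2 × Σ X (λ x → h x ≡ true)) ↔ X
halving {X} h f ff hf = mk↔ₛ′ merge split merge-split split-merge
  where
  Half = Fin 2 × Σ X (λ x → h x ≡ true)
  merge : Half → X
  merge (zero , x , _) = x
  merge (suc zero , x , _) = f x
  split′ : ∀ x b → h x ≡ b → Half
  split′ x true e = zero , x , e
  split′ x false e = suc zero , f x , trans (hf x) (cong not e)
  split : X → Half
  split x = split′ x (h x) refl
  merge-split′ : ∀ x b (e : h x ≡ b) → merge (split′ x b e) ≡ x
  merge-split′ x true e = refl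
  merge-split′ x false e = ff x
  merge-split : ∀ x → merge (split x) ≡ x
  merge-split x = merge-split′ x (h x) refl
  at-true : ∀ x b (e′ : h x ≡ b) (e : h x ≡ true) → split′ x b e′ ≡ (zero , x , e)
  at-true x true e′ e = cong (λ q → zero , x , q) (Bool-irrelevant e′ e)
  at-true x false e′ e with () ← trans (sym e′) e
  at-false : ∀ x b (e′ : h (f x) ≡ b) (e : h x ≡ true) → split′ (f x) b e′ ≡ (suc zero , x , e)
  at-false x true e′ e with () ← trans (sym e′) (trans (hf x) (cong not e))
  at-false x false e′ e = cong (suc zero ,_) (Σ-≡ Bool-irrelevant (ff x))
  split-merge : ∀ p → split (merge p) ≡ p
  split-merge (zero , x , e) = at-true x (h x) refl e
  split-merge (suc zero , x , e) = at-false x (h (f x)) refl e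

-- The count behind the factor 2^p: two copies of the extra data making the
-- total number of parts odd amount to 2 ^ #zeros′ A copies of the parity
-- requirement of D_S on the L remaining parts.
parityChoices : ∀ {t} (A : Fin t → ℕ) L →
  (Fin 2 × Σ (Extras A) (λ e → OddNat (extraTotal {A = A} e + L))) ↔ (Fin (2 ^ #zeros′ A) × ParityReq (anyZero A) L)
parityChoices A L with #zeros A in eq
... | zero = ↔-refl ×-↔ (trivial ⊙ mk↔ₛ′ proj₂ (tt ,_) (λ _ → refl) (λ _ → refl))
  where
  trivial : Σ (Extras A) (λ e → OddNat (extraTotal {A = A} e + L)) ↔ Σ ⊤ (λ _ → OddNat L)
  trivial = Σ-↔ (Extras-trivial A eq)
    (λ e p → subst (λ n → OddNat (n + L)) (extraTotal-trivial A eq e) p)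
    (λ _ p → subst (λ n → OddNat (n + L)) (sym (extraTotal-trivial A eq _)) p) ℕP.≡-irrelevant ℕP.≡-irrelevant
... | suc z = (↔-refl ×-↔ Σ-congʳ (λ e → OddNat↔odd (extraTotal {A = A} e + L)))
    ⊙ halving (λ e → odd (extraTotal {A = A} e + L)) (flipFirst A) (flipFirst-involutive A) flips
    ⊙ subst (λ n → Extras A ↔ Fin (2 ^ n)) eq (Extras↔Fin A)
    ⊙ mk↔ₛ′ (_, tt) proj₁ (λ _ → refl) (λ _ → refl)
  where
  flips : ∀ e → odd (extraTotal {A = A} (flipFirst A e) + L) ≡ not (odd (extraTotal {A = A} e + L))
  flips e rewrite odd-+ (extraTotal {A = A} (flipFirst A e)) L | odd-+ (extraTotal {A = A} e) L | flipFirst-parity A z eq e =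
    sym (BP.not-distribˡ-xor (odd (extraTotal {A = A} e)) (odd L))

-- Assembly: Fin 2 × Sol C A k N ↔ Fin (2 ^ #zeros′ A) × DS C A (N - k)

module Assembly {t} (C A : Fin t → ℕ) (C≥1 : ∀ i → 1 ≤ C i) (half : ∀ i → 2 * A i ≤ C i) (k N : ℕ) where

  Condition : ℤ × ℤ → Set
  Condition s = OddInt (proj₁ s) × (proj₂ s ℤ.+ + k ≡ + N)

  Condition-irrelevant : ∀ {s} (p q : Condition s) → p ≡ q
  Condition-irrelevant (a , b) (a′ , b′) = cong₂ _,_ (ℕP.≡-irrelevant a a′) (ℤ-irrelevant b b′)

  vectorStat : Vec Partition t × Vec ℤ t → ℤ × ℤ
  vectorStat (μ , d) = Σℤ (lookup d) ,
    (Σℤ (λ i → + C i ℤ.* + ∣ lookup μ i ∣ₚ) ℤ.+ Σℤ (λ i → + C i ℤ.* binom2 (lookup d i)) ℤ.+ Σℤ (λ i → + A i ℤ.* lookup d i))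

  Sol↔vectors : Sol C A k N ↔ Σ (Vec Partition t × Vec ℤ t) (λ p → Condition (vectorStat p))
  Sol↔vectors = mk↔ₛ′ (λ (μ , d , r) → (μ , d) , r) (λ ((μ , d) , r) → μ , d , r) (λ _ → refl) (λ _ → refl)

  Tuples : Set
  Tuples = Tuple t (λ _ → Partition × ℤ)

  tupleStat : Tuples → ℤ × ℤ
  tupleStat x = Σℤ (λ i → proj₂ (get x i)) , Σℤ (λ i → solWeight (C i) (A i) (get x i))

  vectorStat≡tupleStat : ∀ p → vectorStat p ≡ tupleStat (to Vec²↔Tuple p)
  vectorStat≡tupleStat (μ , d) = cong₂ _,_ (Σℤ-ext (λ i → cong proj₂ (sym (get-Vec²↔Tuple μ d i))))
    (trans (cong (ℤ._+ Σℤ h) (sym (Σℤ-+ f g)))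
      (trans (sym (Σℤ-+ (λ i → f i ℤ.+ g i) h))
        (Σℤ-ext (λ i → cong (solWeight (C i) (A i)) (sym (get-Vec²↔Tuple μ d i))))))
    where
    f g h : Fin t → ℤ
    f i = + C i ℤ.* + ∣ lookup μ i ∣ₚ
    g i = + C i ℤ.* binom2 (lookup d i)
    h i = + A i ℤ.* lookup d i

  vectors↔tuples : Σ (Vec Partition t × Vec ℤ t) (λ p → Condition (vectorStat p)) ↔ Σ Tuples (λ x → Condition (tupleStat x))
  vectors↔tuples = Σ-↔-stat Vec²↔Tuple vectorStat tupleStat vectorStat≡tupleStat Condition (λ {s} → Condition-irrelevant {s})

  F : ∀ i → FactorBijection (C i) (A i)
  F i = factor (C i) (A i) (C≥1 i) (half i)

  tuples↔factors : Tuples ↔ (Extras A × SPart C A)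
  tuples↔factors = Tuple-map (λ i → FactorBijection.bij (F i)) ⊙ Tuple-split

  plusLength minusLength : SPart C A → ℕ
  plusLength y = Σℕ (λ i → lengthD (proj₁ (get y i)))
  minusLength y = Σℕ (λ i → lengthD (proj₂ (get y i)))

  factorStat : Extras A × SPart C A → ℤ × ℤ
  factorStat (e , y) = (+ (extraTotal {A = A} e + plusLength y) ℤ.- + minusLength y) , + SPartSum y

  get-extras : ∀ x i → get (proj₁ (to tuples↔factors x)) i ≡ proj₁ (to (FactorBijection.bij (F i)) (get x i))
  get-extras x i = trans (get-split₁ (to (Tuple-map (λ i → FactorBijection.bij (F i))) x) i)
    (cong proj₁ (get-map (λ i → FactorBijection.bij (F i)) x i))

  get-parts : ∀ x i → get (proj₂ (to tuples↔factors x)) i ≡ proj₂ (to (FactorBijection.bij (F i)) (get x i))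
  get-parts x i = trans (get-split₂ (to (Tuple-map (λ i → FactorBijection.bij (F i))) x) i)
    (cong proj₂ (get-map (λ i → FactorBijection.bij (F i)) x i))

  tupleStat≡factorStat : ∀ x → tupleStat x ≡ factorStat (to tuples↔factors x)
  tupleStat≡factorStat x = cong₂ _,_ total-charge total-weight
    where
    e = proj₁ (to tuples↔factors x)
    y = proj₂ (to tuples↔factors x)
    image : ∀ i → Extra (does (A i ℕ.≟ 0)) × DistinctPair (C i) (A i)
    image i = to (FactorBijection.bij (F i)) (get x i)
    total-charge : Σℤ (λ i → proj₂ (get x i)) ≡ + (extraTotal {A = A} e + plusLength y) ℤ.- + minusLength y
    total-charge = begin
      Σℤ (λ i → proj₂ (get x i))
        ≡⟨ Σℤ-ext (λ i → FactorBijection.bij-charge (F i) (get x i)) ⟩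
      Σℤ (λ i → + (extraCount (proj₁ (image i)) + lengthD (proj₁ (proj₂ (image i)))) ℤ.- + lengthD (proj₂ (proj₂ (image i))))
        ≡⟨ Σℤ-sub (λ i → extraCount (proj₁ (image i)) + lengthD (proj₁ (proj₂ (image i)))) (λ i → lengthD (proj₂ (proj₂ (image i)))) ⟩
      + Σℕ (λ i → extraCount (proj₁ (image i)) + lengthD (proj₁ (proj₂ (image i)))) ℤ.- + Σℕ (λ i → lengthD (proj₂ (proj₂ (image i))))
        ≡⟨ cong₂ (λ a b → + a ℤ.- + b)
             (trans (Σℕ-+ (λ i → extraCount (proj₁ (image i))) (λ i → lengthD (proj₁ (proj₂ (image i)))))
               (cong₂ _+_ (Σℕ-ext (λ i → cong extraCount (sym (get-extras x i))))
                          (Σℕ-ext (λ i → cong (λ z → lengthD (proj₁ z)) (sym (get-parts x i))))))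
             (Σℕ-ext (λ i → cong (λ z → lengthD (proj₂ z)) (sym (get-parts x i)))) ⟩
      + (extraTotal {A = A} e + plusLength y) ℤ.- + minusLength y ∎
      where open ≡-Reasoning
    total-weight : Σℤ (λ i → solWeight (C i) (A i) (get x i)) ≡ + SPartSum y
    total-weight = begin
      Σℤ (λ i → solWeight (C i) (A i) (get x i))
        ≡⟨ Σℤ-ext (λ i → FactorBijection.bij-weight (F i) (get x i)) ⟩
      Σℤ (λ i → + (sumD (proj₁ (proj₂ (image i))) + sumD (proj₂ (proj₂ (image i)))))
        ≡⟨ Σℤ-pos (λ i → sumD (proj₁ (proj₂ (image i))) + sumD (proj₂ (proj₂ (image i)))) ⟩
      + Σℕ (λ i → sumD (proj₁ (proj₂ (image i))) + sumD (proj₂ (proj₂ (image i))))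
        ≡⟨ cong +_ (Σℕ-ext (λ i → cong (λ z → sumD (proj₁ z) + sumD (proj₂ z)) (sym (get-parts x i)))) ⟩
      + SPartSum y ∎
      where open ≡-Reasoning

  tuples↔factors-Σ : Σ Tuples (λ x → Condition (tupleStat x)) ↔ Σ (Extras A × SPart C A) (λ m → Condition (factorStat m))
  tuples↔factors-Σ = Σ-↔-stat tuples↔factors tupleStat factorStat tupleStat≡factorStat Condition (λ {s} → Condition-irrelevant {s})

  Residual : Extras A × SPart C A → Set
  Residual (e , y) = OddNat (extraTotal {A = A} e + SPartLength y) × (+ SPartSum y ≡ + N ℤ.- + k)

  shift-k : ∀ (x : ℤ) → (x ℤ.+ + k ≡ + N) ↔ (x ≡ + N ℤ.- + k)
  shift-k x = prop-↔ (λ p → trans (L x (+ k)) (cong (ℤ._- + k) p)) (λ p → trans (cong (ℤ._+ + k) p) (L′ (+ N) (+ k)))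
    ℤ-irrelevant ℤ-irrelevant
    where
    L : ∀ (x y : ℤ) → x ≡ (x ℤ.+ y) ℤ.- y
    L = solve-∀
    L′ : ∀ (x y : ℤ) → (x ℤ.- y) ℤ.+ y ≡ x
    L′ = solve-∀

  condition↔residual : Σ (Extras A × SPart C A) (λ m → Condition (factorStat m)) ↔ Σ (Extras A × SPart C A) Residual
  condition↔residual = Σ-congʳ (λ (e , y) →
    (OddInt-sub (extraTotal {A = A} e + plusLength y) (minusLength y)
      ⊙ subst (λ n → OddNat (extraTotal {A = A} e + plusLength y + minusLength y) ↔ OddNat n) (lengths e y) ↔-refl)
    ×-↔ shift-k (+ SPartSum y))
    where
    lengths : ∀ e y → extraTotal {A = A} e + plusLength y + minusLength y ≡ extraTotal {A = A} e + SPartLength y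
    lengths e y = trans (ℕP.+-assoc (extraTotal {A = A} e) (plusLength y) (minusLength y))
      (cong (ℕ._+_ (extraTotal {A = A} e))
        (sym (Σℕ-+ (λ i → lengthD (proj₁ (get y i))) (λ i → lengthD (proj₂ (get y i))))))

  halve-extras : (Fin 2 × Σ (Extras A × SPart C A) Residual) ↔ (Fin (2 ^ #zeros′ A) × DS C A (+ N ℤ.- + k))
  halve-extras =
    mk↔ₛ′ (λ (b , (e , y) , p , q) → y , q , b , e , p) (λ (y , q , b , e , p) → b , (e , y) , p , q) (λ _ → refl) (λ _ → refl)
    ⊙ Σ-congʳ (λ y → ↔-refl ×-↔ parityChoices A (SPartLength y))
    ⊙ mk↔ₛ′ (λ (y , q , b , r) → b , y , q , r) (λ (b , y , q , r) → y , q , b , r) (λ _ → refl) (λ _ → refl)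

  side : (Fin 2 × Sol C A k N) ↔ (Fin (2 ^ #zeros′ A) × DS C A (+ N ℤ.- + k))
  side = (↔-refl ×-↔ (Sol↔vectors ⊙ vectors↔tuples ⊙ tuples↔factors-Σ ⊙ condition↔residual)) ⊙ halve-extras

-- Finiteness

Finite : Set → Set
Finite A = Σ ℕ (λ n → A ↔ Fin n)

fin-iso : ∀ {A B : Set} → A ↔ B → Finite B → Finite A
fin-iso f (n , g) = n , (f ⊙ g)

fin-⊤ : Finite ⊤
fin-⊤ = 1 , ↔-sym FinP.1↔⊤

fin-⊥ : Finite ⊥
fin-⊥ = 0 , ↔-sym FinP.0↔⊥

fin-⊎ : ∀ {A B : Set} → Finite A → Finite B → Finite (A ⊎ B)
fin-⊎ (a , f) (b , g) = (a + b) , ((f ⊎-↔ g) ⊙ ↔-sym (FinP.+↔⊎ {a} {b}))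

fin-× : ∀ {A B : Set} → Finite A → Finite B → Finite (A × B)
fin-× (a , f) (b , g) = (a * b) , ((f ×-↔ g) ⊙ ↔-sym (FinP.*↔× {a} {b}))

Σ-Fin-suc : ∀ {n} (F : Fin (suc n) → Set) → Σ (Fin (suc n)) F ↔ (F zero ⊎ Σ (Fin n) (λ i → F (suc i)))
Σ-Fin-suc F = mk↔ₛ′ split join split-join join-split
  where
  split : Σ _ F → F zero ⊎ Σ _ (λ i → F (suc i))
  split (zero , x) = inj₁ x
  split (suc i , x) = inj₂ (i , x)
  join : F zero ⊎ Σ _ (λ i → F (suc i)) → Σ _ F
  join (inj₁ x) = zero , x
  join (inj₂ (i , x)) = suc i , x
  split-join : ∀ y → split (join y) ≡ y
  split-join (inj₁ x) = refl
  split-join (inj₂ _) = refl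
  join-split : ∀ y → join (split y) ≡ y
  join-split (zero , x) = refl
  join-split (suc i , x) = refl

fin-ΣFin : ∀ n (F : Fin n → Set) → (∀ i → Finite (F i)) → Finite (Σ (Fin n) F)
fin-ΣFin zero F h = fin-iso (mk↔ₛ′ (λ { (() , _) }) (λ ()) (λ ()) (λ { (() , _) })) fin-⊥
fin-ΣFin (suc n) F h = fin-iso (Σ-Fin-suc F) (fin-⊎ (h zero) (fin-ΣFin n (λ i → F (suc i)) (λ i → h (suc i))))

fin-prop : ∀ {P : Set} → Dec P → (∀ (p q : P) → p ≡ q) → Finite P
fin-prop (yes p) irr = fin-iso (prop-↔ _ (λ _ → p) irr (λ _ _ → refl)) fin-⊤
fin-prop (no ¬p) irr = fin-iso (prop-↔ ¬p ⊥-elim irr (λ ())) fin-⊥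

fin-dec : ∀ {A : Set} (P : A → Set) → Finite A → (∀ x → Dec (P x)) → Irrelevant P → Finite (Σ A P)
fin-dec {A} P (n , f) d irr =
  fin-iso (Σ-↔ {Q = λ i → P (from f i)} f (λ x p → subst P (sym (from-to f x)) p) (λ y q → q) irr irr)
    (fin-ΣFin n (λ i → P (from f i)) (λ i → fin-prop (d (from f i)) irr))

cancel-Fin2 : ∀ {A B : Set} → Finite A → Finite B → (Fin 2 × A) ↔ (Fin 2 × B) → A ↔ B
cancel-Fin2 (a , f) (b , g) h = f ⊙ subst (λ k → Fin a ↔ Fin k) a≡b ↔-refl ⊙ ↔-sym g
  where
  2a≡2b : 2 * a ≡ 2 * b
  2a≡2b = ↔⇒≡ (FinP.*↔× {2} {a} ⊙ (↔-refl ×-↔ ↔-sym f) ⊙ h ⊙ (↔-refl ×-↔ g) ⊙ ↔-sym (FinP.*↔× {2} {b}))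
  a≡b : a ≡ b
  a≡b = ℕP.*-cancelˡ-≡ a b 2 2a≡2b

fin-unFin2 : ∀ {X : Set} → Finite (Fin 2 × X) → Finite X
fin-unFin2 {X} f = fin-iso first-copy (fin-dec _ f (λ p → proj₁ p FinP.≟ zero) Fin-irrelevant)
  where
  first-copy : X ↔ Σ (Fin 2 × X) (λ p → proj₁ p ≡ zero)
  first-copy = mk↔ₛ′ (λ x → (zero , x) , refl) (λ p → proj₂ (proj₁ p)) (λ { ((zero , x) , refl) → refl }) (λ _ → refl)

fibres : ∀ {X : Set} n (w : X → ℕ) → (∀ x → w x ≤ n) → X ↔ Σ (Fin (suc n)) (λ j → Σ X (λ x → w x ≡ toℕ j))
fibres {X} n w bound = mk↔ₛ′ into (λ (j , x , e) → x) into-out (λ _ → refl)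
  where
  Fibres = Σ (Fin (suc n)) (λ j → Σ X (λ x → w x ≡ toℕ j))
  into : X → Fibres
  into x = fromℕ< (s≤s (bound x)) , x , sym (FinP.toℕ-fromℕ< (s≤s (bound x)))
  same : ∀ {j j′ : Fin (suc n)} → j′ ≡ j → ∀ {x} {e : w x ≡ toℕ j′} {e′ : w x ≡ toℕ j} → _≡_ {A = Fibres} (j′ , x , e) (j , x , e′)
  same refl {e = e} {e′} = cong (λ q → _ , _ , q) (ℕP.≡-irrelevant e e′)
  into-out : ∀ y → into (proj₁ (proj₂ y)) ≡ y
  into-out (j , x , e) = same (FinP.toℕ-injective (trans (FinP.toℕ-fromℕ< (s≤s (bound x))) e))

fin-fibres : ∀ {X : Set} n (w : X → ℕ) → (∀ x → w x ≤ n) → (∀ m → m ≤ n → Finite (Σ X (λ x → w x ≡ m))) → Finite X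
fin-fibres n w bound h = fin-iso (fibres n w bound) (fin-ΣFin (suc n) _ (λ j → h (toℕ j) (FinP.toℕ≤pred[n] j)))

fin-sum2 : ∀ {X Y : Set} (f : X → ℕ) (g : Y → ℕ) → (∀ m → Finite (Σ X (λ a → f a ≡ m))) → (∀ m → Finite (Σ Y (λ b → g b ≡ m))) →
  ∀ n → Finite (Σ (X × Y) (λ p → f (proj₁ p) + g (proj₂ p) ≡ n))
fin-sum2 {X} {Y} f g finX finY n =
  fin-fibres n (λ p → f (proj₁ (proj₁ p))) (λ ((a , b) , e) → ℕP.≤-trans (ℕP.m≤m+n (f a) (g b)) (ℕP.≤-reflexive e))
    (λ m m≤n → fin-iso (fibre m m≤n) (fin-× (finX m) (finY (n ∸ m))))
  where
  fibre : ∀ m → m ≤ n → Σ (Σ (X × Y) (λ p → f (proj₁ p) + g (proj₂ p) ≡ n)) (λ p → f (proj₁ (proj₁ p)) ≡ m)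
                  ↔ (Σ X (λ a → f a ≡ m) × Σ Y (λ b → g b ≡ n ∸ m))
  fibre m m≤n = mk↔ₛ′
    (λ (((a , b) , e) , e′) → (a , e′) , (b , trans (sym (ℕP.m+n∸m≡n (f a) (g b))) (trans (cong (_∸ f a) e) (cong (n ∸_) e′))))
    (λ ((a , e′) , (b , e″)) → ((a , b) , trans (cong₂ _+_ e′ e″) (ℕP.m+[n∸m]≡n m≤n)) , e′)
    (λ ((a , e′) , (b , e″)) → cong (λ q → (a , e′) , (b , q)) (ℕP.≡-irrelevant _ _))
    (λ (((a , b) , e) , e′) → cong (λ q → ((a , b) , q) , e′) (ℕP.≡-irrelevant _ _))

fin-tuple : ∀ {t} (F : Fin t → Set) (w : ∀ i → F i → ℕ) → (∀ i m → Finite (Σ (F i) (λ a → w i a ≡ m))) →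
  ∀ n → Finite (Σ (Tuple t F) (λ x → Σℕ (λ i → w i (get x i)) ≡ n))
fin-tuple {zero} F w h n = fin-dec _ fin-⊤ (λ _ → 0 ℕP.≟ n) ℕP.≡-irrelevant
fin-tuple {suc t} F w h n = fin-sum2 (w zero) (λ r → Σℕ (λ i → w (suc i) (get r i))) (h zero)
  (fin-tuple (λ i → F (suc i)) (λ i → w (suc i)) (λ i → h (suc i))) n

-- Compositions of m (lists of positive integers with sum m) are finitely
-- many: split by the first part.
Composition : ℕ → Set
Composition m = Σ (List ℕ) (λ xs → All (0 <_) xs × sum xs ≡ m)

Composition-irrelevant : ∀ {xs : List ℕ} {m} (p q : All (0 <_) xs × sum xs ≡ m) → p ≡ q
Composition-irrelevant (a , b) (a′ , b′) = cong₂ _,_ (All.irrelevant ℕP.≤-irrelevant a a′) (ℕP.≡-irrelevant b b′)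

Composition0↔⊤ : Composition 0 ↔ ⊤
Composition0↔⊤ = mk↔ₛ′ (λ _ → tt) (λ _ → [] , [] , refl) (λ _ → refl) unique
  where
  unique : ∀ (c : Composition 0) → ([] , [] , refl) ≡ c
  unique ([] , [] , refl) = refl
  unique (suc x ∷ xs , _ ∷ _ , ())

firstPart-1 : ∀ {m} → Composition m → ℕ
firstPart-1 ([] , _) = 0
firstPart-1 (x ∷ xs , _) = x ∸ 1

firstPart-bound : ∀ m (c : Composition (suc m)) → firstPart-1 c ≤ m
firstPart-bound m ([] , _ , ())
firstPart-bound m (suc x ∷ xs , _ ∷ _ , e) = ℕP.≤-trans (ℕP.m≤m+n x (sum xs)) (ℕP.≤-reflexive (ℕP.suc-injective e))

firstPart-fibre : ∀ m j → j ≤ m → Σ (Composition (suc m)) (λ c → firstPart-1 c ≡ j) ↔ Composition (m ∸ j)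
firstPart-fibre m j j≤m = mk↔ₛ′ rest cons rest-cons cons-rest
  where
  rest : Σ (Composition (suc m)) (λ c → firstPart-1 c ≡ j) → Composition (m ∸ j)
  rest (([] , _ , ()) , _)
  rest ((suc x ∷ xs , _ ∷ pos , e) , ew) =
    xs , pos , trans (sym (ℕP.m+n∸m≡n x (sum xs))) (trans (cong (_∸ x) (ℕP.suc-injective e)) (cong (m ∸_) ew))
  cons : Composition (m ∸ j) → Σ (Composition (suc m)) (λ c → firstPart-1 c ≡ j)
  cons (xs , pos , e) = (suc j ∷ xs , s≤s z≤n ∷ pos , cong suc (trans (cong (ℕ._+_ j) e) (ℕP.m+[n∸m]≡n j≤m))) , refl
  rest-cons : ∀ c → rest (cons c) ≡ c
  rest-cons (xs , pos , e) = cong (λ q → xs , pos , q) (ℕP.≡-irrelevant _ _)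
  cons-rest : ∀ c → cons (rest c) ≡ c
  cons-rest (([] , _ , ()) , _)
  cons-rest ((suc x ∷ xs , px ∷ pos , e) , ew) =
    Σ-≡ ℕP.≡-irrelevant (Σ-≡ Composition-irrelevant (cong (λ z → suc z ∷ xs) (sym ew)))

fin-Composition : ∀ m → Finite (Composition m)
fin-Composition m = bounded m m ℕP.≤-refl
  where
  bounded : ∀ n m → m ≤ n → Finite (Composition m)
  bounded n zero _ = fin-iso Composition0↔⊤ fin-⊤
  bounded (suc n) (suc m) (s≤s m≤n) = fin-fibres m firstPart-1 (firstPart-bound m)
    (λ j j≤m → fin-iso (firstPart-fibre m j j≤m) (bounded n (m ∸ j) (ℕP.≤-trans (ℕP.m∸n≤m m j) m≤n)))

-- Sets of distinct parts from a decidable class with a given sum are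
-- finitely many: they are the strictly decreasing compositions in the class.
fin-Distinct : ∀ (Pr : ℕ → Set) → (∀ k → Dec (Pr k)) → (∀ {k} (p q : Pr k) → p ≡ q) →
  ∀ m → Finite (Σ (DistinctIn Pr) (λ d → sumD d ≡ m))
fin-Distinct Pr dec irr m = fin-iso as-compositions
  (fin-dec _ (fin-Composition m) (λ c → Lk.linked? (λ x y → y ℕP.<? x) (proj₁ c) ×-dec All.all? dec (proj₁ c)) (λ {c} → shape-irrelevant {c}))
  where
  shape-irrelevant : ∀ {c : Composition m} (p q : Linked _>_ (proj₁ c) × All Pr (proj₁ c)) → p ≡ q
  shape-irrelevant (a , b) (a′ , b′) = cong₂ _,_ (Linked>-irrelevant a a′) (All.irrelevant irr b b′)
  as-compositions : Σ (DistinctIn Pr) (λ d → sumD d ≡ m) ↔ Σ (Composition m) (λ c → Linked _>_ (proj₁ c) × All Pr (proj₁ c))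
  as-compositions = mk↔ₛ′ (λ (mkDistinct xs l g , e) → (xs , All.map proj₁ g , e) , l , All.map proj₂ g)
    (λ ((xs , pos , e) , l , pr) → mkDistinct xs l (All.zip (pos , pr)) , e)
    (λ ((xs , pos , e) , l , pr) → Σ-≡ (λ {c} → shape-irrelevant {c}) (Σ-≡ Composition-irrelevant refl))
    (λ (d , e) → Σ-≡ ℕP.≡-irrelevant (Distinct-≡ irr refl))

ParityReq-dec : ∀ b n → Dec (ParityReq b n)
ParityReq-dec true n = yes tt
ParityReq-dec false n = (n % 2) ℕP.≟ 1

ParityReq-irrelevant : ∀ {b n} (p q : ParityReq b n) → p ≡ q
ParityReq-irrelevant {true} p q = refl
ParityReq-irrelevant {false} p q = ℕP.≡-irrelevant p q

fin-DS : ∀ {t} (C A : Fin t → ℕ) → (∀ i → 1 ≤ C i) → ∀ M → Finite (DS C A M)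
fin-DS C A C≥1 -[1+ n ] = fin-iso (mk↔ₛ′ (λ { (_ , () , _) }) (λ ()) (λ ()) (λ { (_ , () , _) })) fin-⊥
fin-DS {t} C A C≥1 (+ n) = fin-iso by-sum
  (fin-dec _ with-sum (λ p → ParityReq-dec (anyZero A) (SPartLength (proj₁ p))) ParityReq-irrelevant)
  where
  with-sum : Finite (Σ (SPart C A) (λ x → SPartSum x ≡ n))
  with-sum = fin-tuple _ (λ i pq → sumD (proj₁ pq) + sumD (proj₂ pq))
    (λ i → fin-sum2 sumD sumD
      (fin-Distinct _ (λ k → C i ℕD.∣? ∣ + k ℤ.- + A i ∣) (∣-irrelevant (C≥1 i)))
      (fin-Distinct _ (λ k → C i ℕD.∣? ∣ + k ℤ.+ + A i ∣) (∣-irrelevant (C≥1 i)))) n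
  by-sum : DS C A (+ n) ↔ Σ (Σ (SPart C A) (λ x → SPartSum x ≡ n)) (λ p → ParityReq (anyZero A) (SPartLength (proj₁ p)))
  by-sum = mk↔ₛ′ (λ (x , e , p) → (x , cong ∣_∣ e) , p) (λ ((x , e) , p) → x , cong +_ e , p)
    (λ ((x , e) , p) → cong (λ q → (x , q) , p) (ℕP.≡-irrelevant _ _))
    (λ (x , e , p) → cong (λ q → x , q , p) (ℤ-irrelevant _ _))

theorem2p3 : (t : ℕ) → 1 ≤ t →
    (C A B : Fin t → ℕ) →
    (∀ i → 1 ≤ C i) → (∀ i → 2 * A i ≤ C i) → (∀ i → 2 * B i ≤ C i) →
    (m N₀ : ℕ) → 1 ≤ N₀ →
    ((∀ N → N₀ ≤ N → Sol C A 0 N ↔ Sol C B m N)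
      ⇔
     (∀ N → N₀ ≤ N →
        (Fin (2 ^ #zeros′ A) × DS C A (+ N))
          ↔ (Fin (2 ^ #zeros′ B) × DS C B (+ N - + m))))
theorem2p3 t _ C A B C≥1 halfA halfB m N₀ _ = mk⇔ i⇒ii ii⇒i
  where
  sideA : ∀ N → (Fin 2 × Sol C A 0 N) ↔ (Fin (2 ^ #zeros′ A) × DS C A (+ N))
  sideA N = Assembly.side C A C≥1 halfA 0 N
    ⊙ (↔-refl ×-↔ subst (λ M → DS C A (+ N - + 0) ↔ DS C A M) (ℤP.+-identityʳ (+ N)) ↔-refl)
  sideB : ∀ N → (Fin 2 × Sol C B m N) ↔ (Fin (2 ^ #zeros′ B) × DS C B (+ N - + m))
  sideB N = Assembly.side C B C≥1 halfB m N
  i⇒ii : (∀ N → N₀ ≤ N → Sol C A 0 N ↔ Sol C B m N) →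
         ∀ N → N₀ ≤ N → (Fin (2 ^ #zeros′ A) × DS C A (+ N)) ↔ (Fin (2 ^ #zeros′ B) × DS C B (+ N - + m))
  i⇒ii sol N N≥N₀ = ↔-sym (sideA N) ⊙ (↔-refl ×-↔ sol N N≥N₀) ⊙ sideB N
  ii⇒i : (∀ N → N₀ ≤ N → (Fin (2 ^ #zeros′ A) × DS C A (+ N)) ↔ (Fin (2 ^ #zeros′ B) × DS C B (+ N - + m))) →
         ∀ N → N₀ ≤ N → Sol C A 0 N ↔ Sol C B m N
  ii⇒i ds N N≥N₀ = cancel-Fin2 (finite-Sol (sideA N) (fin-DS C A C≥1 (+ N))) (finite-Sol (sideB N) (fin-DS C B C≥1 (+ N - + m)))
    (sideA N ⊙ ds N N≥N₀ ⊙ ↔-sym (sideB N))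
    where
    finite-Sol : ∀ {S D : Set} {n} → (Fin 2 × S) ↔ (Fin n × D) → Finite D → Finite S
    finite-Sol side finD = fin-unFin2 (fin-iso side (fin-× (_ , ↔-refl) finD))
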